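{- Let $G$ be an instance of \textsc{Stable Matching} and let $S$ be the set of matchings produced by the Disjoint Stable Matchings algorithm described in the context on input $G$. Then $S$ is a set of pairwise edge-disjoint stable matchings of $G$ of maximum size, i.e., every set of pairwise edge-disjoint stable matchings of $G$ has at most $|S|$ members.
   Context: An instance of \textsc{Stable Matching}: a complete bipartite graph $G$ with sides $\mathcal{M}$ (men) and $\mathcal{W}$ (women), $|\mathcal{M}|=|\mathcal{W}|=n$, where each person has a strictly ordered preference list of all persons of the other side (earlier = more preferred). For a perfect matching $M$, $p_M(x)$ is the partner of $x$. A pair $(m,w)$ blocks $M$ if $w$ prefers $m$ to $p_M(w)$ and $m$ prefers $w$ to $p_M(m)$; $M$ is stable if no pair blocks it. "Deleting a pair $(m,w)$" means removing $m$ from $w$'s current list and $w$ from $m$'s current list. Extended Gale-Shapley (GS-Extended), operating on the current (modifiable) lists: all persons start free; while some man $m$ is free: let $w$ be the first woman on $m$'s current list; if some man $p$ is engaged to $w$, make $p$ free; engage $m$ and $w$; for each successor $m'$ of $m$ on $w$'s current list, delete the pair $(m',w)$. Return the set of engaged pairs. Disjoint Stable Matchings algorithm on input $G$: set $S\gets\varnothing$. Compute the woman-optimal stable matching $M_z$ of $G$ (by the woman-proposing Gale-Shapley algorithm on the original lists). Set $X\gets$ GS-Extended$(G)$ (modifying the lists). While $X\cap M_z=\varnothing$: put $S\gets S\cup\{X\}$; for every man $m$, delete the first woman $w$ on $m$'s current list (which is $m$'s partner in $X$) and delete the last man on $w$'s current list (which is $w$'s partner in $X$); then set $X\gets$ GS-Extended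 on the current lists. After the loop, put $S\gets S\cup\{M_z\}$ and return $S$. -}

module Defs where

open import Data.Nat using (ℕ; suc; _≤_)
open import Data.Fin using (Fin; _≟_)
open import Data.Bool using (Bool; true; false; if_then_else_)
open import Data.Maybe using (Maybe; just; nothing)
open import Data.List using (List; []; _∷_; _++_; filter; length; foldl)
open import Data.List.Base using (allFin)
open import Data.List.Membership.Propositional using (_∈_)
open import Data.List.Relation.Binary.Permutation.Propositional using (_↭_)
open import Data.List.Relation.Unary.All using (All)
open import Data.List.Relation.Unary.AllPairs using (AllPairs)
open import Data.Product using (Σ; ∃; _×_; _,_)
open import Data.Sum using (_⊎_)
open import Data.Empty using (⊥)
open import Relation.Nullary using (¬_; does; ¬?)
open import Relation.Binary.PropositionalEquality using (_≡_)
open import Relation.Binary.Construct.Closure.ReflexiveTransitive using (Star)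
import Data.List.Membership.DecPropositional as DecMem

-- Each person has a strictly
-- ordered preference list of ALL persons of the other side, i.e. a list
-- that is a permutation of allFin n (earlier = more preferred).

record Instance (n : ℕ) : Set where
  field
    prefM : Fin n → List (Fin n)
    prefW : Fin n → List (Fin n)
    prefM-perm : ∀ m → prefM m ↭ allFin n
    prefW-perm : ∀ w → prefW w ↭ allFin n

Before : ∀ {n} → Fin n → Fin n → List (Fin n) → Set
Before {n} x y l = Σ (List (Fin n)) λ as → Σ (List (Fin n)) λ bs →
  (l ≡ as ++ (x ∷ bs)) × (y ∈ bs)

-- Matchings: a (partial) matching is given by the partner of each woman.
-- The pair (m , w) belongs to μ iff μ w ≡ just m.

WMap : ℕ → Set
WMap n = Fin n → Maybe (Fin n)

Perfect : ∀ {n} → WMap n → Set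
Perfect {n} μ = (∀ w → ∃ λ m → μ w ≡ just m)
              × (∀ w w' m → μ w ≡ just m → μ w' ≡ just m → w ≡ w')

Stable : ∀ {n} → Instance n → WMap n → Set
Stable {n} G μ = Perfect μ ×
  (∀ (m w m' w' : Fin n) → μ w ≡ just m' → μ w' ≡ just m →
     Before m m' (Instance.prefW G w) → Before w w' (Instance.prefM G m) → ⊥)

WomanOptimal : ∀ {n} → Instance n → WMap n → Set
WomanOptimal {n} G μ = Stable G μ ×
  (∀ μ' → Stable G μ' → ∀ (w m m' : Fin n) → μ w ≡ just m → μ' w ≡ just m' →
     (m ≡ m') ⊎ Before m m' (Instance.prefW G w))

Disjoint : ∀ {n} → WMap n → WMap n → Set
Disjoint {n} μ ν = ∀ (m w : Fin n) → μ w ≡ just m → ν w ≡ just m → ⊥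

upd : ∀ {n} {A : Set} → (Fin n → A) → Fin n → A → Fin n → A
upd f i v j = if does (i ≟ j) then v else f j

after : ∀ {n} → Fin n → List (Fin n) → List (Fin n)
after m [] = []
after m (x ∷ xs) = if does (x ≟ m) then xs else after m xs

through : ∀ {n} → Fin n → List (Fin n) → List (Fin n)
through m [] = []
through m (x ∷ xs) = if does (x ≟ m) then x ∷ [] else x ∷ through m xs

dropLast : ∀ {A : Set} → List A → List A
dropLast [] = []
dropLast (x ∷ []) = []
dropLast (x ∷ y ∷ xs) = x ∷ dropLast (y ∷ xs)

tail : ∀ {A : Set} → List A → List A
tail [] = []
tail (x ∷ xs) = xs

remove : ∀ {n} → Fin n → List (Fin n) → List (Fin n)
remove w = filter (λ x → ¬? (x ≟ w))

record Lists (n : ℕ) : Set where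
  constructor lists
  field
    ml : Fin n → List (Fin n)
    wl : Fin n → List (Fin n)
open Lists public

initLists : ∀ {n} → Instance n → Lists n
initLists G = lists (Instance.prefM G) (Instance.prefW G)

record GSState (n : ℕ) : Set where
  constructor gsstate
  field
    lsts : Lists n
    eng  : WMap n
open GSState public

Free : ∀ {n} → GSState n → Fin n → Set
Free s m = ∀ w → eng s w ≡ just m → ⊥

-- m (free) proposes to w (first on his current list): w gets engaged to m
-- (her previous fiancé, if any, becomes free), and every successor m' of m
-- on w's current list has the pair (m', w) deleted.
propose : ∀ {n} → GSState n → Fin n → Fin n → GSState n
propose {n} s m w = gsstate (lists ml' wl') (upd (eng s) w (just m))
  where
  open DecMem (_≟_ {n})
  L = lsts s
  succs = after m (wl L w)
  ml' : Fin n → List (Fin n)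
  ml' m' = if does (m' ∈? succs) then remove w (ml L m') else ml L m'
  wl' : Fin n → List (Fin n)
  wl' = upd (wl L) w (through m (wl L w))

data GSStep {n : ℕ} : GSState n → GSState n → Set where
  step : ∀ {s} m w rest → Free s m → ml (lsts s) m ≡ w ∷ rest →
         GSStep s (propose s m w)

GSExt : ∀ {n} → Lists n → Lists n → WMap n → Set
GSExt {n} L L' X = Σ (GSState n) λ s →
  Star GSStep (gsstate L (λ _ → nothing)) s ×
  (∀ m → Free s m → ⊥) × (lsts s ≡ L') × (eng s ≡ X)

delFor : ∀ {n} → Lists n → Fin n → Lists n
delFor L m with ml L m
... | [] = L
... | w ∷ rest = lists (upd (ml L) m rest) (upd (wl L) w (dropLast (wl L w)))

delStep : ∀ {n} → Lists n → Lists n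
delStep {n} L = foldl delFor L (allFin n)

data Loop {n : ℕ} (Mz : WMap n) : Lists n → List (WMap n) → Set where
  done : ∀ {L L' X} → GSExt L L' X → ¬ Disjoint X Mz → Loop Mz L (Mz ∷ [])
  next : ∀ {L L' X S} → GSExt L L' X → Disjoint X Mz →
         Loop Mz (delStep L') S → Loop Mz L (X ∷ S)

DSM : ∀ {n} → Instance n → List (WMap n) → Set
DSM {n} G S = Σ (WMap n) λ Mz → WomanOptimal G Mz × Loop Mz (initLists G) S

-- GS-Extended never deletes a pair of a stable matching lying within the current lists, and it returns
-- the stable matching X that is best for every man among those; the deletion step then removes exactly
-- the pairs of X.  For maximality, take k pairwise edge-disjoint stable matchings within the lists.
-- Repeatedly replacing two of them by their join and meet (man-best and man-worst) keeps k pairwise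
-- edge-disjoint stable matchings, one of which is strictly better for every man than the other k − 1.
-- X is at least as good as that one, so the other k − 1 are edge-disjoint from X and survive the
-- deletion, and induction gives at least k − 1 further matchings.  When X meets the woman-optimal
-- matching Mz, which is the worst stable matching for every man, every stable matching within the
-- lists agrees with X at the man where they meet, so no two of them are edge-disjoint.
module Submission where

open import Defs
open import Data.Bool using (if_then_else_)
open import Data.Empty using (⊥; ⊥-elim)
open import Data.Fin using (Fin; _≟_; zero; suc; punchOut)
open import Data.Fin.Properties using (any?; all?; punchOut-injective; injective⇒≤)
open import Data.List using (List; []; _∷_; _++_; [_]; length; allFin; foldl)
open import Data.List.Properties
  using (++-identityʳ; ++-assoc; ∷-injective; ∷ʳ-injective; length-filter; filter-notAll; filter-accept)
open import Data.List.Membership.Propositional using (_∈_; _∉_)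
open import Data.List.Membership.Propositional.Properties
  using (∈-allFin; ∈-++⁺ˡ; ∈-++⁺ʳ; ∈-++⁻; ∈-filter⁺; ∈-filter⁻)
import Data.List.Membership.DecPropositional as DecMembership
open import Data.List.Relation.Binary.Permutation.Propositional using (_↭_; ↭-sym; ↭⇒↭ₛ)
open import Data.List.Relation.Binary.Permutation.Propositional.Properties using (∈-resp-↭)
import Data.List.Relation.Binary.Permutation.Setoid.Properties as PermutationSetoid
open import Data.List.Relation.Binary.Pointwise using (Pointwise; []; _∷_; Pointwise-length)
open import Data.List.Relation.Unary.All as All using (All; []; _∷_)
open import Data.List.Relation.Unary.All.Properties using (All¬⇒¬Any; ¬Any⇒All¬)
open import Data.List.Relation.Unary.AllPairs using (AllPairs; []; _∷_)
import Data.List.Relation.Unary.AllPairs.Properties as AllPairs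
open import Data.List.Relation.Unary.Any as Any using (Any; here; there)
open import Data.List.Relation.Unary.Unique.Propositional using (Unique)
open import Data.List.Relation.Unary.Unique.Propositional.Properties using (allFin⁺)
open import Data.Maybe using (Maybe; just; nothing)
open import Data.Maybe.Properties using (just-injective; ≡-dec)
open import Data.Nat using (ℕ; zero; suc; _+_; _≤_; _<_; z≤n; s≤s; s<s⁻¹)
open import Data.Nat.Induction using (<-wellFounded)
open import Data.Nat.Properties
  using (≤-refl; ≤-reflexive; ≤-trans; ≤-antisym; <-irrefl; <-asym; <-trans; <⇒≤; ≤-<-trans; <-≤-trans;
         ≰⇒>; ≤∧≢⇒<; _≤?_; <-cmp; n≮0; suc-injective; m≤m+n; +-monoʳ-<; +-mono-≤; +-mono-<-≤; +-mono-≤-<; 1+n≰n)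
open import Data.Product using (Σ; ∃; _×_; _,_; proj₁; proj₂)
open import Data.Sum using (_⊎_; inj₁; inj₂)
open import Function using (_∘_; case_of_)
open import Induction.WellFounded using (Acc; acc)
open import Relation.Binary.Construct.Closure.ReflexiveTransitive using (Star; ε; _◅_)
open import Relation.Binary.Definitions using (tri<; tri≈; tri>)
open import Relation.Binary.PropositionalEquality
  using (_≡_; _≢_; refl; sym; trans; cong; subst; subst₂; setoid)
open import Relation.Nullary using (yes; no; does; ¬?)

module _ {n : ℕ} where

  -- An element absent from l gets rank length l.
  rank : List (Fin n) → Fin n → ℕ
  rank []       x = 0
  rank (y ∷ ys) x = if does (y ≟ x) then 0 else suc (rank ys x)

  rank-here : ∀ x ys → rank (x ∷ ys) x ≡ 0
  rank-here x ys with x ≟ x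
  ... | yes _ = refl
  ... | no x≢x = ⊥-elim (x≢x refl)

  rank-there : ∀ {x y} ys → y ≢ x → rank (y ∷ ys) x ≡ suc (rank ys x)
  rank-there {x} {y} ys y≢x with y ≟ x
  ... | yes y≡x = ⊥-elim (y≢x y≡x)
  ... | no _ = refl

  rank<length : ∀ {x} l → x ∈ l → rank l x < length l
  rank<length {x} (y ∷ ys) x∈ with y ≟ x
  rank<length {x} (y ∷ ys) x∈          | yes _ = s≤s z≤n
  rank<length {x} (y ∷ ys) (here x≡y)  | no y≢x = ⊥-elim (y≢x (sym x≡y))
  rank<length {x} (y ∷ ys) (there x∈) | no _ = s≤s (rank<length ys x∈)

  rank-injective : ∀ {x y} l → x ∈ l → rank l x ≡ rank l y → x ≡ y
  rank-injective {x} {y} (z ∷ zs) x∈ eq with z ≟ x | z ≟ y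
  rank-injective (z ∷ zs) x∈          eq | yes z≡x | yes z≡y = trans (sym z≡x) z≡y
  rank-injective (z ∷ zs) x∈          () | yes _   | no _
  rank-injective (z ∷ zs) x∈          () | no _    | yes _
  rank-injective (z ∷ zs) (here x≡z)  eq | no z≢x  | no _ = ⊥-elim (z≢x (sym x≡z))
  rank-injective (z ∷ zs) (there x∈) eq | no _    | no _ = rank-injective zs x∈ (suc-injective eq)

  rank-++ˡ : ∀ {x} xs ys → x ∈ xs → rank (xs ++ ys) x ≡ rank xs x
  rank-++ˡ {x} (z ∷ zs) ys x∈ with z ≟ x
  rank-++ˡ (z ∷ zs) ys x∈          | yes _ = refl
  rank-++ˡ (z ∷ zs) ys (here x≡z)  | no z≢x = ⊥-elim (z≢x (sym x≡z))
  rank-++ˡ (z ∷ zs) ys (there x∈) | no _ = cong suc (rank-++ˡ zs ys x∈)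

  rank-++ʳ : ∀ {x} xs ys → x ∉ xs → rank (xs ++ ys) x ≡ length xs + rank ys x
  rank-++ʳ [] ys _ = refl
  rank-++ʳ {x} (z ∷ zs) ys x∉ with z ≟ x
  ... | yes z≡x = ⊥-elim (x∉ (here (sym z≡x)))
  ... | no _ = cong suc (rank-++ʳ zs ys (x∉ ∘ there))

  Unique-++⇒∉ : ∀ {x} (xs ys : List (Fin n)) → Unique (xs ++ ys) → x ∈ xs → x ∉ ys
  Unique-++⇒∉ (z ∷ zs) ys (z∉ ∷ _) (here refl) x∈ys = All¬⇒¬Any z∉ (∈-++⁺ʳ zs x∈ys)
  Unique-++⇒∉ (z ∷ zs) ys (_ ∷ u)  (there x∈)  x∈ys = Unique-++⇒∉ zs ys u x∈ x∈ys

  Unique-++⁻ʳ : ∀ (xs ys : List (Fin n)) → Unique (xs ++ ys) → Unique ys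
  Unique-++⁻ʳ [] ys u = u
  Unique-++⁻ʳ (_ ∷ xs) ys (_ ∷ u) = Unique-++⁻ʳ xs ys u

  Unique-++⁻ˡ : ∀ (xs ys : List (Fin n)) → Unique (xs ++ ys) → Unique xs
  Unique-++⁻ˡ [] ys u = []
  Unique-++⁻ˡ (x ∷ xs) ys (x∉ ∷ u) = ¬Any⇒All¬ xs (All¬⇒¬Any x∉ ∘ ∈-++⁺ˡ) ∷ Unique-++⁻ˡ xs ys u

  Unique-resp-↭ : ∀ {xs ys : List (Fin n)} → xs ↭ ys → Unique xs → Unique ys
  Unique-resp-↭ p = PermutationSetoid.Unique-resp-↭ (setoid (Fin n)) (↭⇒↭ₛ p)

  Before⇒rank< : ∀ {x y} l → Unique l → Before x y l → rank l x < rank l y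
  Before⇒rank< {x} {y} l u (as , bs , refl , y∈bs) =
    subst₂ _<_ (sym rank-x) (sym rank-y) (+-monoʳ-< (length as) (s≤s z≤n))
    where
    x∉as : x ∉ as
    x∉as x∈as = Unique-++⇒∉ as (x ∷ bs) u x∈as (here refl)
    y∉as : y ∉ as
    y∉as y∈as = Unique-++⇒∉ as (x ∷ bs) u y∈as (there y∈bs)
    x≢y : x ≢ y
    x≢y refl with Unique-++⁻ʳ as (x ∷ bs) u
    ... | x∉bs ∷ _ = All¬⇒¬Any x∉bs y∈bs
    rank-x : rank (as ++ x ∷ bs) x ≡ length as + 0
    rank-x = trans (rank-++ʳ as (x ∷ bs) x∉as) (cong (length as +_) (rank-here x bs))
    rank-y : rank (as ++ x ∷ bs) y ≡ length as + suc (rank bs y)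
    rank-y = trans (rank-++ʳ as (x ∷ bs) y∉as) (cong (length as +_) (rank-there bs x≢y))

  rank<⇒Before : ∀ {x y} l → x ∈ l → y ∈ l → rank l x < rank l y → Before x y l
  rank<⇒Before {x} {y} (z ∷ zs) x∈ y∈ lt with z ≟ x | z ≟ y
  ... | _      | yes _   = ⊥-elim (n≮0 lt)
  ... | yes refl | no z≢y = [] , zs , refl , Any.tail (z≢y ∘ sym) y∈
  ... | no z≢x | no z≢y
    with as , bs , eq , y∈bs ← rank<⇒Before zs (Any.tail (z≢x ∘ sym) x∈) (Any.tail (z≢y ∘ sym) y∈) (s<s⁻¹ lt)
    = z ∷ as , bs , cong (z ∷_) eq , y∈bs

  IsPrefix : List (Fin n) → List (Fin n) → Set
  IsPrefix xs ys = ∃ λ zs → xs ++ zs ≡ ys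

  IsPrefix-refl : ∀ xs → IsPrefix xs xs
  IsPrefix-refl xs = [] , ++-identityʳ xs

  IsPrefix-trans : ∀ {xs ys zs} → IsPrefix xs ys → IsPrefix ys zs → IsPrefix xs zs
  IsPrefix-trans {xs} (us , refl) (vs , refl) = us ++ vs , sym (++-assoc xs us vs)

  Unique-prefix : ∀ {xs ys} → IsPrefix xs ys → Unique ys → Unique xs
  Unique-prefix {xs} (zs , refl) = Unique-++⁻ˡ xs zs

  rank-prefix : ∀ {x xs ys} → IsPrefix xs ys → x ∈ xs → rank xs x ≡ rank ys x
  rank-prefix {xs = xs} (zs , refl) x∈ = sym (rank-++ˡ xs zs x∈)

  IsPrefix-downClosed : ∀ {x y xs ys} → IsPrefix xs ys → y ∈ xs → rank ys x < rank ys y → x ∈ xs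
  IsPrefix-downClosed {x} {y} {xs} (zs , refl) y∈ x<y with x ∈? xs
    where open DecMembership _≟_
  ... | yes x∈ = x∈
  ... | no x∉ = ⊥-elim (<-irrefl refl (<-≤-trans x<len len≤x))
    where
    x<len : rank (xs ++ zs) x < length xs
    x<len = <-trans x<y (subst (_< length xs) (sym (rank-++ˡ xs zs y∈)) (rank<length xs y∈))
    len≤x : length xs ≤ rank (xs ++ zs) x
    len≤x = subst (length xs ≤_) (sym (rank-++ʳ xs zs x∉)) (m≤m+n (length xs) (rank zs x))

  through++after : ∀ m (l : List (Fin n)) → through m l ++ after m l ≡ l
  through++after m [] = refl
  through++after m (x ∷ xs) with x ≟ m
  ... | yes _ = refl
  ... | no _ = cong (x ∷_) (through++after m xs)

  through-isPrefix : ∀ m (l : List (Fin n)) → IsPrefix (through m l) l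
  through-isPrefix m l = after m l , through++after m l

  through⊆ : ∀ {x} m (l : List (Fin n)) → x ∈ through m l → x ∈ l
  through⊆ m l x∈ = subst (_ ∈_) (through++after m l) (∈-++⁺ˡ x∈)

  after⊆ : ∀ {x} m (l : List (Fin n)) → x ∈ after m l → x ∈ l
  after⊆ m l x∈ = subst (_ ∈_) (through++after m l) (∈-++⁺ʳ (through m l) x∈)

  ∈-through⊎after : ∀ {x} m (l : List (Fin n)) → x ∈ l → x ∈ through m l ⊎ x ∈ after m l
  ∈-through⊎after m l x∈ = ∈-++⁻ (through m l) (subst (_ ∈_) (sym (through++after m l)) x∈)

  through-∷ʳ : ∀ {m} (l : List (Fin n)) → m ∈ l → ∃ λ xs → through m l ≡ xs ++ [ m ]
  through-∷ʳ {m} (x ∷ xs) m∈ with x ≟ m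
  through-∷ʳ (x ∷ xs) m∈         | yes refl = [] , refl
  through-∷ʳ (x ∷ xs) (here m≡x) | no x≢m = ⊥-elim (x≢m (sym m≡x))
  through-∷ʳ (x ∷ xs) (there m∈) | no _ with ys , eq ← through-∷ʳ xs m∈ = x ∷ ys , cong (x ∷_) eq

  ∈-through : ∀ {m} (l : List (Fin n)) → m ∈ l → m ∈ through m l
  ∈-through l m∈ with xs , eq ← through-∷ʳ l m∈ = subst (_ ∈_) (sym eq) (∈-++⁺ʳ xs (here refl))

  after⇒∉through : ∀ {x} m l → Unique l → x ∈ after m l → x ∉ through m l
  after⇒∉through m l u x∈ x∈′ =
    Unique-++⇒∉ (through m l) (after m l) (subst Unique (sym (through++after m l)) u) x∈′ x∈

  after⇒≢ : ∀ {x} m l → Unique l → m ∈ l → x ∈ after m l → x ≢ m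
  after⇒≢ m l u m∈ x∈ refl = after⇒∉through m l u x∈ (∈-through l m∈)

  after⇒rank> : ∀ {x} m l → Unique l → m ∈ l → x ∈ after m l → rank l m < rank l x
  after⇒rank> {x} m l u m∈ x∈ =
    subst₂ _<_ rank-m rank-x (<-≤-trans (rank<length (through m l) (∈-through l m∈)) (m≤m+n _ _))
    where
    rank-m : rank (through m l) m ≡ rank l m
    rank-m = rank-prefix (through-isPrefix m l) (∈-through l m∈)
    rank-x : length (through m l) + rank (after m l) x ≡ rank l x
    rank-x = trans (sym (rank-++ʳ (through m l) (after m l) (after⇒∉through m l u x∈)))
                   (cong (λ l′ → rank l′ x) (through++after m l))

  last∈nonemptySuffix : ∀ {p} (xs zs : List (Fin n)) {c cs} → xs ++ [ p ] ≡ zs ++ c ∷ cs → p ∈ c ∷ cs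
  last∈nonemptySuffix xs       []           eq = subst (_ ∈_) eq (∈-++⁺ʳ xs (here refl))
  last∈nonemptySuffix []       (_ ∷ [])     ()
  last∈nonemptySuffix []       (_ ∷ _ ∷ _)  ()
  last∈nonemptySuffix (_ ∷ xs) (_ ∷ zs)     eq = last∈nonemptySuffix xs zs (proj₂ (∷-injective eq))

  last∈after : ∀ {m p} (l xs : List (Fin n)) → m ∈ l → l ≡ xs ++ [ p ] → p ≢ m → p ∈ after m l
  last∈after {m} {p} l xs m∈ l≡ p≢m with through-∷ʳ l m∈ | after m l | through++after m l
  ... | ys , through≡ | [] | split =
    ⊥-elim (p≢m (sym (proj₂ (∷ʳ-injective ys xs
      (trans (sym through≡) (trans (sym (++-identityʳ _)) (trans split l≡)))))))
  ... | _ | _ ∷ _ | split = last∈nonemptySuffix xs (through m l) (trans (sym l≡) (sym split))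

  dropLast-∷ʳ : ∀ (xs : List (Fin n)) x → dropLast (xs ++ [ x ]) ≡ xs
  dropLast-∷ʳ []           x = refl
  dropLast-∷ʳ (y ∷ [])     x = refl
  dropLast-∷ʳ (y ∷ z ∷ xs) x = cong (y ∷_) (dropLast-∷ʳ (z ∷ xs) x)

  dropLast-isPrefix : ∀ (l : List (Fin n)) → IsPrefix (dropLast l) l
  dropLast-isPrefix []          = [] , refl
  dropLast-isPrefix (x ∷ [])    = x ∷ [] , refl
  dropLast-isPrefix (x ∷ y ∷ l) with zs , eq ← dropLast-isPrefix (y ∷ l) = zs , cong (x ∷_) eq

  ∈-remove⁻ : ∀ {x w} (l : List (Fin n)) → x ∈ remove w l → x ∈ l × x ≢ w
  ∈-remove⁻ {w = w} l = ∈-filter⁻ (λ x → ¬? (x ≟ w))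

  ∈-remove⁺ : ∀ {x w} (l : List (Fin n)) → x ∈ l → x ≢ w → x ∈ remove w l
  ∈-remove⁺ {w = w} l = ∈-filter⁺ (λ x → ¬? (x ≟ w))

  remove-∷ : ∀ {w y} (l : List (Fin n)) → y ≢ w → remove w (y ∷ l) ≡ y ∷ remove w l
  remove-∷ {w} l = filter-accept (λ x → ¬? (x ≟ w))

  length-remove-≤ : ∀ w (l : List (Fin n)) → length (remove w l) ≤ length l
  length-remove-≤ w = length-filter (λ x → ¬? (x ≟ w))

  length-remove-< : ∀ {w} (l : List (Fin n)) → w ∈ l → length (remove w l) < length l
  length-remove-< {w} l w∈ = filter-notAll (λ x → ¬? (x ≟ w)) l (Any.map (λ w≡x x≢w → x≢w (sym w≡x)) w∈)

  StartsWith : Fin n → List (Fin n) → Set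
  StartsWith w l = ∃ λ rest → l ≡ w ∷ rest

  EndsWith : Fin n → List (Fin n) → Set
  EndsWith m l = ∃ λ xs → l ≡ xs ++ [ m ]

  SortedBy : (Fin n → ℕ) → List (Fin n) → Set
  SortedBy r = AllPairs (λ a b → r a < r b)

  head-rank< : ∀ {r w rest x} → SortedBy r (w ∷ rest) → x ∈ rest → r w < r x
  head-rank< (w<rest ∷ _) x∈ = All.lookup w<rest x∈

  Before⇒AllPairs : ∀ {R : Fin n → Fin n → Set} (l : List (Fin n)) → (∀ {a b} → Before a b l → R a b) → AllPairs R l
  Before⇒AllPairs [] _ = []
  Before⇒AllPairs (x ∷ xs) before⇒R =
    All.tabulate (λ b∈ → before⇒R ([] , xs , refl , b∈)) ∷
    Before⇒AllPairs xs (λ (as , bs , eq , b∈) → before⇒R (x ∷ as , bs , cong (x ∷_) eq , b∈))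

sumFin : ∀ {n} → (Fin n → ℕ) → ℕ
sumFin {zero}  f = 0
sumFin {suc n} f = f zero + sumFin (f ∘ suc)

sumFin-mono-≤ : ∀ {n} (f g : Fin n → ℕ) → (∀ i → f i ≤ g i) → sumFin f ≤ sumFin g
sumFin-mono-≤ {zero}  f g f≤g = z≤n
sumFin-mono-≤ {suc n} f g f≤g = +-mono-≤ (f≤g zero) (sumFin-mono-≤ (f ∘ suc) (g ∘ suc) (f≤g ∘ suc))

sumFin-mono-< : ∀ {n} (f g : Fin n → ℕ) → (∀ i → f i ≤ g i) → ∀ j → f j < g j → sumFin f < sumFin g
sumFin-mono-< {suc n} f g f≤g zero    fj<gj = +-mono-<-≤ fj<gj (sumFin-mono-≤ (f ∘ suc) (g ∘ suc) (f≤g ∘ suc))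
sumFin-mono-< {suc n} f g f≤g (suc j) fj<gj = +-mono-≤-< (f≤g zero) (sumFin-mono-< (f ∘ suc) (g ∘ suc) (f≤g ∘ suc) j fj<gj)

injective⇒surjective : ∀ {n} (f : Fin n → Fin n) → (∀ x y → f x ≡ f y → x ≡ y) → ∀ y → ∃ λ x → f x ≡ y
injective⇒surjective {suc k} f f-inj y with any? (λ x → f x ≟ y)
... | yes hit = hit
... | no miss = ⊥-elim (1+n≰n (injective⇒≤ {f = squeeze} squeeze-injective))
  where
  squeeze : Fin (suc k) → Fin k
  squeeze x = punchOut {i = y} {j = f x} (λ y≡fx → miss (x , sym y≡fx))
  squeeze-injective : ∀ {x z} → squeeze x ≡ squeeze z → x ≡ z
  squeeze-injective {x} {z} eq =
    f-inj x z (punchOut-injective (λ e → miss (x , sym e)) (λ e → miss (z , sym e)) eq)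

upd-same : ∀ {n} {A : Set} (f : Fin n → A) i v → upd f i v i ≡ v
upd-same f i v with i ≟ i
... | yes _ = refl
... | no i≢i = ⊥-elim (i≢i refl)

upd-other : ∀ {n} {A : Set} (f : Fin n → A) i v j → i ≢ j → upd f i v j ≡ f j
upd-other f i v j i≢j with i ≟ j
... | yes i≡j = ⊥-elim (i≢j i≡j)
... | no _ = refl

record Matching (n : ℕ) : Set where
  field
    manOf         : Fin n → Fin n
    womanOf       : Fin n → Fin n
    manOf-womanOf : ∀ m → manOf (womanOf m) ≡ m
    womanOf-manOf : ∀ w → womanOf (manOf w) ≡ w
open Matching public

module _ {n : ℕ} (p : Matching n) where

  womanOf-injective : ∀ {x y} → womanOf p x ≡ womanOf p y → x ≡ y
  womanOf-injective {x} {y} eq = trans (sym (manOf-womanOf p x)) (trans (cong (manOf p) eq) (manOf-womanOf p y))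

  manOf≡⇒womanOf≡ : ∀ {w m} → manOf p w ≡ m → womanOf p m ≡ w
  manOf≡⇒womanOf≡ {w} refl = womanOf-manOf p w

  womanOf≡⇒manOf≡ : ∀ {m w} → womanOf p m ≡ w → manOf p w ≡ m
  womanOf≡⇒manOf≡ {m} refl = manOf-womanOf p m

swapSides : ∀ {n} → Instance n → Instance n
swapSides G = record
  { prefM = Instance.prefW G ; prefW = Instance.prefM G
  ; prefM-perm = Instance.prefW-perm G ; prefW-perm = Instance.prefM-perm G }

swapMatching : ∀ {n} → Matching n → Matching n
swapMatching p = record
  { manOf = womanOf p ; womanOf = manOf p
  ; manOf-womanOf = womanOf-manOf p ; womanOf-manOf = manOf-womanOf p }

module _ {n : ℕ} where

  record _Represents_ (p : Matching n) (μ : WMap n) : Set where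
    constructor represents
    field
      matches : ∀ w → μ w ≡ just (manOf p w)
  open _Represents_ public

  toWMap : Matching n → WMap n
  toWMap p w = just (manOf p w)

  EdgeDisjoint : Matching n → Matching n → Set
  EdgeDisjoint p q = ∀ m → womanOf p m ≢ womanOf q m

  module _ {p : Matching n} {μ : WMap n} (p⊢μ : p Represents μ) where

    represents-womanOf : ∀ {w m} → μ w ≡ just m → womanOf p m ≡ w
    represents-womanOf {w} μw≡m = manOf≡⇒womanOf≡ p (just-injective (trans (sym (matches p⊢μ w)) μw≡m))

    represents-manOf : ∀ m → μ (womanOf p m) ≡ just m
    represents-manOf m = trans (matches p⊢μ (womanOf p m)) (cong just (manOf-womanOf p m))

    represents-Perfect : Perfect μ
    represents-Perfect = (λ w → manOf p w , matches p⊢μ w) ,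
      (λ w w′ m μw≡m μw′≡m → trans (sym (represents-womanOf μw≡m)) (represents-womanOf μw′≡m))

  fromInjective : (f : Fin n → Fin n) → (∀ x y → f x ≡ f y → x ≡ y) → Matching n
  fromInjective f f-injective = record
    { manOf = f ; womanOf = f⁻¹ ; manOf-womanOf = f∘f⁻¹
    ; womanOf-manOf = λ w → f-injective _ _ (f∘f⁻¹ (f w)) }
    where
    f⁻¹ : Fin n → Fin n
    f⁻¹ m = proj₁ (injective⇒surjective f f-injective m)
    f∘f⁻¹ : ∀ m → f (f⁻¹ m) ≡ m
    f∘f⁻¹ m = proj₂ (injective⇒surjective f f-injective m)

  Perfect⇒Matching : (μ : WMap n) → Perfect μ → Σ (Matching n) (_Represents μ)
  Perfect⇒Matching μ (partner , partner-unique) = fromInjective man man-injective , represents (proj₂ ∘ partner)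
    where
    man : Fin n → Fin n
    man w = proj₁ (partner w)
    man-injective : ∀ w w′ → man w ≡ man w′ → w ≡ w′
    man-injective w w′ eq =
      partner-unique w w′ (man w) (proj₂ (partner w)) (subst (λ m → μ w′ ≡ just m) (sym eq) (proj₂ (partner w′)))

  shared-or-disjoint : ∀ (p q : Matching n) → (∃ λ m → womanOf p m ≡ womanOf q m) ⊎ EdgeDisjoint p q
  shared-or-disjoint p q with any? (λ m → womanOf p m ≟ womanOf q m)
  ... | yes shared = inj₁ shared
  ... | no none = inj₂ (λ m same → none (m , same))

module _ {A : Set} (r : A → ℕ) where

  minBy : A → A → A
  minBy x y with r x ≤? r y
  ... | yes _ = x
  ... | no _ = y

  minBy-≤ˡ : ∀ x y → r (minBy x y) ≤ r x
  minBy-≤ˡ x y with r x ≤? r y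
  ... | yes _ = ≤-refl
  ... | no x≰y = <⇒≤ (≰⇒> x≰y)

  minBy-≤ʳ : ∀ x y → r (minBy x y) ≤ r y
  minBy-≤ʳ x y with r x ≤? r y
  ... | yes x≤y = x≤y
  ... | no _ = ≤-refl

  minBy-cases : ∀ x y → (minBy x y ≡ x × r x ≤ r y) ⊎ (minBy x y ≡ y × r y ≤ r x)
  minBy-cases x y with r x ≤? r y
  ... | yes x≤y = inj₁ (refl , x≤y)
  ... | no x≰y = inj₂ (refl , <⇒≤ (≰⇒> x≰y))

module Preferences {n : ℕ} (G : Instance n) where
  open Instance G

  rankM : Fin n → Fin n → ℕ
  rankM m = rank (prefM m)

  rankW : Fin n → Fin n → ℕ
  rankW w = rank (prefW w)

  ∈-prefM : ∀ m w → w ∈ prefM m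
  ∈-prefM m w = ∈-resp-↭ (↭-sym (prefM-perm m)) (∈-allFin w)

  ∈-prefW : ∀ w m → m ∈ prefW w
  ∈-prefW w m = ∈-resp-↭ (↭-sym (prefW-perm w)) (∈-allFin m)

  Unique-prefM : ∀ m → Unique (prefM m)
  Unique-prefM m = Unique-resp-↭ (↭-sym (prefM-perm m)) (allFin⁺ n)

  Unique-prefW : ∀ w → Unique (prefW w)
  Unique-prefW w = Unique-resp-↭ (↭-sym (prefW-perm w)) (allFin⁺ n)

  rankM-injective : ∀ m {w w′} → rankM m w ≡ rankM m w′ → w ≡ w′
  rankM-injective m = rank-injective (prefM m) (∈-prefM m _)

  rankW-injective : ∀ w {m m′} → rankW w m ≡ rankW w m′ → m ≡ m′
  rankW-injective w = rank-injective (prefW w) (∈-prefW w _)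

  record RankStable (p : Matching n) : Set where
    constructor rankStable
    field
      unblocked : ∀ m w → rankW w m < rankW w (manOf p w) → rankM m w < rankM m (womanOf p m) → ⊥
  open RankStable public

  RankStable⇒Stable : ∀ {p μ} → p Represents μ → RankStable p → Stable G μ
  RankStable⇒Stable {p} p⊢μ p-stable = represents-Perfect p⊢μ , no-blocking-pair
    where
    no-blocking-pair : ∀ m w m′ w′ → _ ≡ just m′ → _ ≡ just m →
      Before m m′ (prefW w) → Before w w′ (prefM m) → ⊥
    no-blocking-pair m w m′ w′ μw≡m′ μw′≡m m<m′ w<w′ = unblocked p-stable m w
      (subst (λ x → rankW w m < rankW w x) (just-injective (trans (sym μw≡m′) (matches p⊢μ w)))
             (Before⇒rank< (prefW w) (Unique-prefW w) m<m′))
      (subst (λ x → rankM m w < rankM m x) (sym (represents-womanOf p⊢μ μw′≡m))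
             (Before⇒rank< (prefM m) (Unique-prefM m) w<w′))

  Stable⇒RankStable : ∀ {p μ} → p Represents μ → Stable G μ → RankStable p
  Stable⇒RankStable {p} p⊢μ (_ , no-blocking-pair) = rankStable λ m w w<p m<p →
    no-blocking-pair m w (manOf p w) (womanOf p m) (matches p⊢μ w) (represents-manOf p⊢μ m)
      (rank<⇒Before (prefW w) (∈-prefW w m) (∈-prefW w _) w<p)
      (rank<⇒Before (prefM m) (∈-prefM m w) (∈-prefM m _) m<p)

  EdgeDisjoint⇒Disjoint : ∀ {p q : Matching n} {μ ν} → p Represents μ → q Represents ν → EdgeDisjoint p q → Disjoint μ ν
  EdgeDisjoint⇒Disjoint p⊢μ q⊢ν p∩q=∅ m w μw≡m νw≡m =
    p∩q=∅ m (trans (represents-womanOf p⊢μ μw≡m) (sym (represents-womanOf q⊢ν νw≡m)))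

  Disjoint⇒EdgeDisjoint : ∀ {p q : Matching n} {μ ν} → p Represents μ → q Represents ν → Disjoint μ ν → EdgeDisjoint p q
  Disjoint⇒EdgeDisjoint {p} {q} {μ} {ν} p⊢μ q⊢ν μ∩ν=∅ m same =
    μ∩ν=∅ m (womanOf p m) (represents-manOf p⊢μ m) (subst (λ w → ν w ≡ just m) (sym same) (represents-manOf q⊢ν m))

  ≤∧≢⇒rankM< : ∀ m {w w′} → rankM m w ≤ rankM m w′ → w ≢ w′ → rankM m w < rankM m w′
  ≤∧≢⇒rankM< m w≤w′ w≢w′ = ≤∧≢⇒< w≤w′ (w≢w′ ∘ rankM-injective m)

  RankStable⇒rival-preferred : ∀ {q} → RankStable q → ∀ {m w} →
    rankM m w < rankM m (womanOf q m) → rankW w (manOf q w) < rankW w m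
  RankStable⇒rival-preferred {q} q-stable {m} {w} m-prefers-w with <-cmp (rankW w (manOf q w)) (rankW w m)
  ... | tri< lt _ _ = lt
  ... | tri≈ _ eq _ = ⊥-elim (<-irrefl (cong (rankM m) w≡qm) m-prefers-w)
    where
    w≡qm : w ≡ womanOf q m
    w≡qm = sym (manOf≡⇒womanOf≡ q (rankW-injective w eq))
  ... | tri> _ _ gt = ⊥-elim (unblocked q-stable m w gt m-prefers-w)

  RankStable⇒weakly-preferred : ∀ {q} → RankStable q → ∀ {m w} →
    rankM m w ≤ rankM m (womanOf q m) → rankW w (manOf q w) ≤ rankW w m
  RankStable⇒weakly-preferred {q} q-stable {m} {w} w≤qm with womanOf q m ≟ w
  ... | yes qm≡w = ≤-reflexive (cong (rankW w) (womanOf≡⇒manOf≡ q qm≡w))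
  ... | no qm≢w = <⇒≤ (RankStable⇒rival-preferred q-stable (≤∧≢⇒rankM< m w≤qm (qm≢w ∘ sym)))

  -- If x ≢ y, w forms a blocking pair, with x for q or with y for p.
  no-crossing : ∀ {p q} → RankStable p → RankStable q → ∀ {x y} →
    rankM x (womanOf p x) ≤ rankM x (womanOf q x) → rankM y (womanOf q y) ≤ rankM y (womanOf p y) →
    womanOf p x ≡ womanOf q y → x ≡ y
  no-crossing {p} {q} p-stable q-stable {x} {y} x≤ y≤ px≡qy with x ≟ y
  ... | yes x≡y = x≡y
  ... | no x≢y = ⊥-elim (<-asym y<x x<y)
    where
    w : Fin n
    w = womanOf p x
    y<x : rankW w y < rankW w x
    y<x = subst (λ m → rankW w m < rankW w x) (womanOf≡⇒manOf≡ q (sym px≡qy))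
            (RankStable⇒rival-preferred q-stable
              (≤∧≢⇒rankM< x x≤ (λ px≡qx → x≢y (womanOf-injective q (trans (sym px≡qx) px≡qy)))))
    y-prefers-w : rankM y w ≤ rankM y (womanOf p y)
    y-prefers-w = subst (λ w′ → rankM y w′ ≤ rankM y (womanOf p y)) (sym px≡qy) y≤
    x<y : rankW w x < rankW w y
    x<y = subst (λ m → rankW w m < rankW w y) (manOf-womanOf p x)
            (RankStable⇒rival-preferred p-stable
              (≤∧≢⇒rankM< y y-prefers-w (λ w≡py → x≢y (womanOf-injective p w≡py))))

  module Join {p q : Matching n} (p-stable : RankStable p) (q-stable : RankStable q) where

    better : Fin n → Fin n
    better m = minBy (rankM m) (womanOf p m) (womanOf q m)

    better-injective : ∀ x y → better x ≡ better y → x ≡ y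
    better-injective x y eq
      with minBy-cases (rankM x) (womanOf p x) (womanOf q x) | minBy-cases (rankM y) (womanOf p y) (womanOf q y)
    ... | inj₁ (px , _)  | inj₁ (py , _)  = womanOf-injective p (trans (sym px) (trans eq py))
    ... | inj₂ (qx , _)  | inj₂ (qy , _)  = womanOf-injective q (trans (sym qx) (trans eq qy))
    ... | inj₁ (px , x≤) | inj₂ (qy , y≤) = no-crossing p-stable q-stable x≤ y≤ (trans (sym px) (trans eq qy))
    ... | inj₂ (qx , x≤) | inj₁ (py , y≤) = sym (no-crossing p-stable q-stable y≤ x≤ (trans (sym py) (trans (sym eq) qx)))

    join : Matching n
    join = swapMatching (fromInjective better better-injective)

    join-≤ˡ : ∀ m → rankM m (womanOf join m) ≤ rankM m (womanOf p m)
    join-≤ˡ m = minBy-≤ˡ (rankM m) (womanOf p m) (womanOf q m)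

    join-≤ʳ : ∀ m → rankM m (womanOf join m) ≤ rankM m (womanOf q m)
    join-≤ʳ m = minBy-≤ʳ (rankM m) (womanOf p m) (womanOf q m)

    womanOf-join : ∀ m → womanOf join m ≡ womanOf p m ⊎ womanOf join m ≡ womanOf q m
    womanOf-join m with minBy-cases (rankM m) (womanOf p m) (womanOf q m)
    ... | inj₁ (eq , _) = inj₁ eq
    ... | inj₂ (eq , _) = inj₂ eq

    manOf-join : ∀ w → manOf join w ≡ manOf p w ⊎ manOf join w ≡ manOf q w
    manOf-join w with womanOf-join (manOf join w)
    ... | inj₁ eq = inj₁ (sym (womanOf≡⇒manOf≡ p (trans (sym eq) (womanOf-manOf join w))))
    ... | inj₂ eq = inj₂ (sym (womanOf≡⇒manOf≡ q (trans (sym eq) (womanOf-manOf join w))))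

    join-stable : RankStable join
    join-stable = rankStable λ m w w-prefers-m m-prefers-w → case manOf-join w of λ where
      (inj₁ eq) → unblocked p-stable m w (subst (λ x → rankW w m < rankW w x) eq w-prefers-m)
                    (<-≤-trans m-prefers-w (join-≤ˡ m))
      (inj₂ eq) → unblocked q-stable m w (subst (λ x → rankW w m < rankW w x) eq w-prefers-m)
                    (<-≤-trans m-prefers-w (join-≤ʳ m))

    join-≥ˡ : ∀ w → rankW w (manOf p w) ≤ rankW w (manOf join w)
    join-≥ˡ w = RankStable⇒weakly-preferred p-stable
      (subst (λ w′ → rankM (manOf join w) w′ ≤ rankM (manOf join w) (womanOf p (manOf join w))) (womanOf-manOf join w)
        (join-≤ˡ (manOf join w)))

    join-≥ʳ : ∀ w → rankW w (manOf q w) ≤ rankW w (manOf join w)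
    join-≥ʳ w = RankStable⇒weakly-preferred q-stable
      (subst (λ w′ → rankM (manOf join w) w′ ≤ rankM (manOf join w) (womanOf q (manOf join w))) (womanOf-manOf join w)
        (join-≤ʳ (manOf join w)))

  represent : ∀ T → All (Stable G) T → Σ (List (Matching n)) λ F → Pointwise _Represents_ F T
  represent [] [] = [] , []
  represent (μ ∷ T) (μ-stable ∷ T-stable) =
    let p , p⊢μ = Perfect⇒Matching μ (proj₁ μ-stable) ; F , F⊢T = represent T T-stable in p ∷ F , p⊢μ ∷ F⊢T

  Pointwise-RankStable : ∀ {F T} → Pointwise _Represents_ F T → All (Stable G) T → All RankStable F
  Pointwise-RankStable [] [] = []
  Pointwise-RankStable (p⊢μ ∷ F⊢T) (μ-stable ∷ T-stable) =
    Stable⇒RankStable p⊢μ μ-stable ∷ Pointwise-RankStable F⊢T T-stable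

  Pointwise-EdgeDisjoint-one : ∀ {p μ F T} → p Represents μ → Pointwise _Represents_ F T →
    All (Disjoint μ) T → All (EdgeDisjoint p) F
  Pointwise-EdgeDisjoint-one p⊢μ [] [] = []
  Pointwise-EdgeDisjoint-one p⊢μ (q⊢ν ∷ F⊢T) (μ∩ν=∅ ∷ μ∩T=∅) =
    Disjoint⇒EdgeDisjoint p⊢μ q⊢ν μ∩ν=∅ ∷ Pointwise-EdgeDisjoint-one p⊢μ F⊢T μ∩T=∅

  Pointwise-EdgeDisjoint : ∀ {F T} → Pointwise _Represents_ F T → AllPairs Disjoint T → AllPairs EdgeDisjoint F
  Pointwise-EdgeDisjoint [] [] = []
  Pointwise-EdgeDisjoint (p⊢μ ∷ F⊢T) (μ∩T=∅ ∷ T-disjoint) =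
    Pointwise-EdgeDisjoint-one p⊢μ F⊢T μ∩T=∅ ∷ Pointwise-EdgeDisjoint F⊢T T-disjoint

module Lattice {n : ℕ} (G : Instance n) where
  open Preferences G
  private module Swapped = Preferences (swapSides G)

  RankStable-swap : ∀ {p} → RankStable p → Swapped.RankStable (swapMatching p)
  RankStable-swap p-stable = Swapped.rankStable λ w m m-prefers-w w-prefers-m → unblocked p-stable m w w-prefers-m m-prefers-w

  RankStable-unswap : ∀ {p} → Swapped.RankStable p → RankStable (swapMatching p)
  RankStable-unswap p-stable = rankStable λ m w w-prefers-m m-prefers-w → Swapped.unblocked p-stable w m m-prefers-w w-prefers-m

  open Join public

  module Meet {p q : Matching n} (p-stable : RankStable p) (q-stable : RankStable q) where
    private module W = Swapped.Join (RankStable-swap p-stable) (RankStable-swap q-stable)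

    meet : Matching n
    meet = swapMatching W.join

    meet-stable : RankStable meet
    meet-stable = RankStable-unswap W.join-stable

    womanOf-meet : ∀ m → womanOf meet m ≡ womanOf p m ⊎ womanOf meet m ≡ womanOf q m
    womanOf-meet = W.manOf-join

    meet-≥ˡ : ∀ m → rankM m (womanOf p m) ≤ rankM m (womanOf meet m)
    meet-≥ˡ = W.join-≥ˡ

    meet-≥ʳ : ∀ m → rankM m (womanOf q m) ≤ rankM m (womanOf meet m)
    meet-≥ʳ = W.join-≥ʳ

  join<meet : ∀ {p q} (p-stable : RankStable p) (q-stable : RankStable q) → ∀ m → womanOf p m ≢ womanOf q m →
    rankM m (womanOf (join p-stable q-stable) m) < rankM m (womanOf (Meet.meet p-stable q-stable) m)
  join<meet {p} {q} p-stable q-stable m p≢q =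
    ≤∧≢⇒< (≤-trans (join-≤ˡ p-stable q-stable m) (meet-≥ˡ m)) λ join≡meet →
      p≢q (rankM-injective m (trans (squeezed (join-≤ˡ p-stable q-stable m) (meet-≥ˡ m) join≡meet)
                                    (sym (squeezed (join-≤ʳ p-stable q-stable m) (meet-≥ʳ m) join≡meet))))
    where
    open Meet p-stable q-stable
    squeezed : ∀ {a b c} → a ≤ b → b ≤ c → a ≡ c → b ≡ a
    squeezed a≤b b≤c refl = ≤-antisym b≤c a≤b

delFor-∷ : ∀ {n} (L : Lists n) m w rest → ml L m ≡ w ∷ rest →
  delFor L m ≡ lists (upd (ml L) m rest) (upd (wl L) w (dropLast (wl L w)))
delFor-∷ L m w rest eq with ml L m | eq
... | .(w ∷ rest) | refl = refl

-- Since the first women on the men's lists are distinct, every woman's list is shortened exactly once.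
module Deletion {n : ℕ} (L₀ : Lists n) (X : Matching n) (X-first : ∀ m → StartsWith (womanOf X m) (ml L₀ m)) where

  record DeletedFor (D : List (Fin n)) (L : Lists n) : Set where
    field
      ml-done    : ∀ m → m ∈ D → ml L m ≡ tail (ml L₀ m)
      ml-pending : ∀ m → m ∉ D → ml L m ≡ ml L₀ m
      wl-done    : ∀ w → manOf X w ∈ D → wl L w ≡ dropLast (wl L₀ w)
      wl-pending : ∀ w → manOf X w ∉ D → wl L w ≡ wl L₀ w

  DeletedFor-resp : ∀ {D D′ L} → (∀ x → x ∈ D′ → x ∈ D) → (∀ x → x ∈ D → x ∈ D′) →
    DeletedFor D L → DeletedFor D′ L
  DeletedFor-resp D′⊆D D⊆D′ del = record
    { ml-done = λ m m∈ → ml-done m (D′⊆D m m∈) ; ml-pending = λ m m∉ → ml-pending m (m∉ ∘ D⊆D′ m)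
    ; wl-done = λ w m∈ → wl-done w (D′⊆D _ m∈) ; wl-pending = λ w m∉ → wl-pending w (m∉ ∘ D⊆D′ _) }
    where open DeletedFor del

  DeletedFor-delFor : ∀ {D L} m → m ∉ D → DeletedFor D L → DeletedFor (m ∷ D) (delFor L m)
  DeletedFor-delFor {D} {L} m m∉D del with rest , first ← X-first m =
    subst (DeletedFor (m ∷ D)) (sym (delFor-∷ L m w rest (trans (ml-pending m m∉D) first))) (record
      { ml-done = ml-done′ ; ml-pending = ml-pending′ ; wl-done = wl-done′ ; wl-pending = wl-pending′ })
    where
    open DeletedFor del
    w : Fin n
    w = womanOf X m
    ml-done′ : ∀ m′ → m′ ∈ m ∷ D → upd (ml L) m rest m′ ≡ tail (ml L₀ m′)
    ml-done′ m′ m′∈ with m ≟ m′ | m′∈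
    ... | yes refl | _ = cong tail (sym first)
    ... | no m≢m′ | here m′≡m = ⊥-elim (m≢m′ (sym m′≡m))
    ... | no _ | there m′∈D = ml-done m′ m′∈D
    ml-pending′ : ∀ m′ → m′ ∉ m ∷ D → upd (ml L) m rest m′ ≡ ml L₀ m′
    ml-pending′ m′ m′∉ with m ≟ m′
    ... | yes refl = ⊥-elim (m′∉ (here refl))
    ... | no _ = ml-pending m′ (m′∉ ∘ there)
    wl-done′ : ∀ w′ → manOf X w′ ∈ m ∷ D → upd (wl L) w (dropLast (wl L w)) w′ ≡ dropLast (wl L₀ w′)
    wl-done′ w′ m′∈ with w ≟ w′ | m′∈
    ... | yes refl | _ = cong dropLast (wl-pending w (subst (_∉ D) (sym (manOf-womanOf X m)) m∉D))
    ... | no w≢w′ | here Xw′≡m = ⊥-elim (w≢w′ (manOf≡⇒womanOf≡ X Xw′≡m))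
    ... | no _ | there m′∈D = wl-done w′ m′∈D
    wl-pending′ : ∀ w′ → manOf X w′ ∉ m ∷ D → upd (wl L) w (dropLast (wl L w)) w′ ≡ wl L₀ w′
    wl-pending′ w′ m′∉ with w ≟ w′
    ... | yes refl = ⊥-elim (m′∉ (here (manOf-womanOf X m)))
    ... | no _ = wl-pending w′ (m′∉ ∘ there)

  DeletedFor-foldl : ∀ ms {D L} → Unique ms → (∀ m → m ∈ ms → m ∉ D) →
    DeletedFor D L → DeletedFor (ms ++ D) (foldl delFor L ms)
  DeletedFor-foldl [] _ _ del = del
  DeletedFor-foldl (m ∷ ms) {D} (m∉ms ∷ u) fresh del =
    DeletedFor-resp reorder reorder⁻¹ (DeletedFor-foldl ms u fresh′ (DeletedFor-delFor m (fresh m (here refl)) del))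
    where
    fresh′ : ∀ x → x ∈ ms → x ∉ m ∷ D
    fresh′ x x∈ms (here refl) = All¬⇒¬Any m∉ms x∈ms
    fresh′ x x∈ms (there x∈D) = fresh x (there x∈ms) x∈D
    reorder : ∀ x → x ∈ m ∷ ms ++ D → x ∈ ms ++ m ∷ D
    reorder x (here refl) = ∈-++⁺ʳ ms (here refl)
    reorder x (there x∈) with ∈-++⁻ ms x∈
    ... | inj₁ x∈ms = ∈-++⁺ˡ x∈ms
    ... | inj₂ x∈D = ∈-++⁺ʳ ms (there x∈D)
    reorder⁻¹ : ∀ x → x ∈ ms ++ m ∷ D → x ∈ m ∷ ms ++ D
    reorder⁻¹ x x∈ with ∈-++⁻ ms x∈
    ... | inj₁ x∈ms = there (∈-++⁺ˡ x∈ms)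
    ... | inj₂ (here x≡m) = here x≡m
    ... | inj₂ (there x∈D) = there (∈-++⁺ʳ ms x∈D)

  deleted : DeletedFor (allFin n ++ []) (delStep L₀)
  deleted = DeletedFor-foldl (allFin n) (allFin⁺ n) (λ _ _ ()) (record
    { ml-done = λ _ () ; ml-pending = λ _ _ → refl ; wl-done = λ _ () ; wl-pending = λ _ _ → refl })

  ml-delStep : ∀ m → ml (delStep L₀) m ≡ tail (ml L₀ m)
  ml-delStep m = DeletedFor.ml-done deleted m (∈-++⁺ˡ (∈-allFin m))

  wl-delStep : ∀ w → wl (delStep L₀) w ≡ dropLast (wl L₀ w)
  wl-delStep w = DeletedFor.wl-done deleted w (∈-++⁺ˡ (∈-allFin _))

module GaleShapley {n : ℕ} (G : Instance n) where
  open Instance G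
  open Preferences G
  open DecMembership (_≟_ {n}) using (_∈?_)

  record Consistent (L : Lists n) : Set where
    field
      on-his⇒on-hers : ∀ m w → w ∈ ml L m → m ∈ wl L w
      on-hers⇒on-his : ∀ m w → m ∈ wl L w → w ∈ ml L m
      men-sorted     : ∀ m → SortedBy (rankM m) (ml L m)
      women-prefix   : ∀ w → IsPrefix (wl L w) (prefW w)

    Unique-wl : ∀ w → Unique (wl L w)
    Unique-wl w = Unique-prefix (women-prefix w) (Unique-prefW w)

    rank-wl : ∀ w {m} → m ∈ wl L w → rank (wl L w) m ≡ rankW w m
    rank-wl w = rank-prefix (women-prefix w)

  record Invariant (s : GSState n) : Set where
    field
      consistent     : Consistent (lsts s)
      fiancée-first  : ∀ w m → eng s w ≡ just m → StartsWith w (ml (lsts s) m)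
      fiancé-last    : ∀ w m → eng s w ≡ just m → EndsWith m (wl (lsts s) w)
      engaged-once   : ∀ w₁ w₂ m → eng s w₁ ≡ just m → eng s w₂ ≡ just m → w₁ ≡ w₂

  Within : Lists n → Matching n → Set
  Within L p = ∀ m → womanOf p m ∈ ml L m

  module Propose (s : GSState n) (m w : Fin n) where
    L : Lists n
    L = lsts s
    rejected : List (Fin n)
    rejected = after m (wl L w)
    s′ : GSState n
    s′ = propose s m w
    L′ : Lists n
    L′ = lsts s′

    ml-rejected : ∀ m′ → m′ ∈ rejected → ml L′ m′ ≡ remove w (ml L m′)
    ml-rejected m′ m′∈ with m′ ∈? rejected
    ... | yes _ = refl
    ... | no m′∉ = ⊥-elim (m′∉ m′∈)

    ml-kept : ∀ m′ → m′ ∉ rejected → ml L′ m′ ≡ ml L m′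
    ml-kept m′ m′∉ with m′ ∈? rejected
    ... | yes m′∈ = ⊥-elim (m′∉ m′∈)
    ... | no _ = refl

    ml-cases : ∀ m′ → ml L′ m′ ≡ ml L m′ ⊎ ml L′ m′ ≡ remove w (ml L m′)
    ml-cases m′ with m′ ∈? rejected
    ... | yes _ = inj₂ refl
    ... | no _ = inj₁ refl

    ml-⊆ : ∀ m′ {x} → x ∈ ml L′ m′ → x ∈ ml L m′
    ml-⊆ m′ x∈ with m′ ∈? rejected
    ... | yes _ = proj₁ (∈-remove⁻ (ml L m′) x∈)
    ... | no _ = x∈

    ml-⊇ : ∀ m′ {x} → x ∈ ml L m′ → x ≢ w → x ∈ ml L′ m′
    ml-⊇ m′ x∈ x≢w with m′ ∈? rejected
    ... | yes _ = ∈-remove⁺ (ml L m′) x∈ x≢w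
    ... | no _ = x∈

    length-ml : ∀ m′ → length (ml L′ m′) ≤ length (ml L m′)
    length-ml m′ with m′ ∈? rejected
    ... | yes _ = length-remove-≤ w (ml L m′)
    ... | no _ = ≤-refl

    eng-proposee : eng s′ w ≡ just m
    eng-proposee = upd-same (eng s) w (just m)

  module Step {s : GSState n} {m w rest} (inv : Invariant s) (m-free : Free s m) (m-first : ml (lsts s) m ≡ w ∷ rest) where
    open Propose s m w
    open Invariant inv
    open Consistent consistent

    w∈ml : w ∈ ml L m
    w∈ml = subst (w ∈_) (sym m-first) (here refl)

    m∈wl : m ∈ wl L w
    m∈wl = on-his⇒on-hers m w w∈ml

    consistent′ : Consistent L′
    consistent′ = record
      { on-his⇒on-hers = on-his⇒on-hers′ ; on-hers⇒on-his = on-hers⇒on-his′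
      ; men-sorted = men-sorted′ ; women-prefix = women-prefix′ }
      where
      on-his⇒on-hers′ : ∀ m′ w′ → w′ ∈ ml L′ m′ → m′ ∈ wl L′ w′
      on-his⇒on-hers′ m′ w′ w′∈ with w ≟ w′
      ... | no _ = on-his⇒on-hers m′ w′ (ml-⊆ m′ w′∈)
      ... | yes refl with ∈-through⊎after m (wl L w) (on-his⇒on-hers m′ w (ml-⊆ m′ w′∈))
      ...   | inj₁ m′∈through = m′∈through
      ...   | inj₂ m′∈rejected =
        ⊥-elim (proj₂ (∈-remove⁻ (ml L m′) (subst (w ∈_) (ml-rejected m′ m′∈rejected) w′∈)) refl)
      on-hers⇒on-his′ : ∀ m′ w′ → m′ ∈ wl L′ w′ → w′ ∈ ml L′ m′
      on-hers⇒on-his′ m′ w′ m′∈ with w ≟ w′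
      ... | no w≢w′ = ml-⊇ m′ (on-hers⇒on-his m′ w′ m′∈) (w≢w′ ∘ sym)
      ... | yes refl = subst (w ∈_) (sym (ml-kept m′ m′∉rejected)) (on-hers⇒on-his m′ w (through⊆ m (wl L w) m′∈))
        where
        m′∉rejected : m′ ∉ rejected
        m′∉rejected m′∈rejected = after⇒∉through m (wl L w) (Unique-wl w) m′∈rejected m′∈
      men-sorted′ : ∀ m′ → SortedBy (rankM m′) (ml L′ m′)
      men-sorted′ m′ with ml-cases m′
      ... | inj₁ eq = subst (SortedBy (rankM m′)) (sym eq) (men-sorted m′)
      ... | inj₂ eq = subst (SortedBy (rankM m′)) (sym eq) (AllPairs.filter⁺ (λ x → ¬? (x ≟ w)) (men-sorted m′))
      women-prefix′ : ∀ w′ → IsPrefix (wl L′ w′) (prefW w′)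
      women-prefix′ w′ with w ≟ w′
      ... | no _ = women-prefix w′
      ... | yes refl = IsPrefix-trans (through-isPrefix m (wl L w)) (women-prefix w)

    invariant′ : Invariant s′
    invariant′ = record
      { consistent = consistent′ ; fiancée-first = fiancée-first′
      ; fiancé-last = fiancé-last′ ; engaged-once = engaged-once′ }
      where
      fiancée-first′ : ∀ w′ m′ → eng s′ w′ ≡ just m′ → StartsWith w′ (ml L′ m′)
      fiancée-first′ w′ m′ e with w ≟ w′
      ... | yes refl with refl ← just-injective e = rest , trans (ml-kept m m∉rejected) m-first
        where
        m∉rejected : m ∉ rejected
        m∉rejected m∈ = after⇒≢ m (wl L w) (Unique-wl w) m∈wl m∈ refl
      ... | no w≢w′ with rest′ , eq ← fiancée-first w′ m′ e with ml-cases m′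
      ...   | inj₁ kept = rest′ , trans kept eq
      ...   | inj₂ pruned = remove w rest′ , trans pruned (trans (cong (remove w) eq) (remove-∷ rest′ (w≢w′ ∘ sym)))
      fiancé-last′ : ∀ w′ m′ → eng s′ w′ ≡ just m′ → EndsWith m′ (wl L′ w′)
      fiancé-last′ w′ m′ e with w ≟ w′
      ... | yes refl with refl ← just-injective e = through-∷ʳ (wl L w) m∈wl
      ... | no _ = fiancé-last w′ m′ e
      engaged-once′ : ∀ w₁ w₂ m′ → eng s′ w₁ ≡ just m′ → eng s′ w₂ ≡ just m′ → w₁ ≡ w₂
      engaged-once′ w₁ w₂ m′ e₁ e₂ with w ≟ w₁ | w ≟ w₂
      ... | yes refl | yes refl = refl
      ... | yes refl | no _ with refl ← just-injective e₁ = ⊥-elim (m-free w₂ e₂)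
      ... | no _ | yes refl with refl ← just-injective e₂ = ⊥-elim (m-free w₁ e₁)
      ... | no _ | no _ = engaged-once w₁ w₂ m′ e₁ e₂

    -- A stable pair (m′ , w) with m′ rejected by w would be blocked by w and the proposer m.
    within′ : ∀ {p} → RankStable p → Within L p → Within L′ p
    within′ {p} p-stable p-within m′ with m′ ∈? rejected
    ... | no _ = p-within m′
    ... | yes m′∈rejected = ∈-remove⁺ (ml L m′) (p-within m′) p≢w
      where
      p≢w : womanOf p m′ ≢ w
      p≢w pm′≡w = unblocked p-stable m w w-prefers-m m-prefers-w
        where
        pw≡m′ : manOf p w ≡ m′
        pw≡m′ = womanOf≡⇒manOf≡ p pm′≡w
        w-prefers-m : rankW w m < rankW w (manOf p w)
        w-prefers-m = subst₂ _<_ (rank-wl w m∈wl)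
                        (trans (rank-wl w (after⊆ m (wl L w) m′∈rejected)) (cong (rankW w) (sym pw≡m′)))
                        (after⇒rank> m (wl L w) (Unique-wl w) m∈wl m′∈rejected)
        pm≢w : womanOf p m ≢ w
        pm≢w pm≡w = after⇒≢ m (wl L w) (Unique-wl w) m∈wl m′∈rejected
                      (trans (sym pw≡m′) (womanOf≡⇒manOf≡ p pm≡w))
        m-prefers-w : rankM m w < rankM m (womanOf p m)
        m-prefers-w with subst (womanOf p m ∈_) m-first (p-within m)
        ... | here pm≡w = ⊥-elim (pm≢w pm≡w)
        ... | there pm∈rest = head-rank< (subst (SortedBy (rankM m)) m-first (men-sorted m)) pm∈rest

  initial : Lists n → GSState n
  initial L = gsstate L (λ _ → nothing)

  initial-invariant : ∀ {L} → Consistent L → Invariant (initial L)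
  initial-invariant L-consistent = record
    { consistent = L-consistent ; fiancée-first = λ _ _ () ; fiancé-last = λ _ _ () ; engaged-once = λ _ _ _ () }

  run-invariant : ∀ {s s′ : GSState n} → Star GSStep s s′ → Invariant s → Invariant s′
  run-invariant ε inv = inv
  run-invariant (step _ _ _ m-free m-first ◅ steps) inv = run-invariant steps (Step.invariant′ inv m-free m-first)

  run-within : ∀ {s s′ : GSState n} → Star GSStep s s′ → Invariant s →
    ∀ {p} → RankStable p → Within (lsts s) p → Within (lsts s′) p
  run-within ε inv p-stable p-within = p-within
  run-within (step _ _ _ m-free m-first ◅ steps) inv p-stable p-within =
    run-within steps (Step.invariant′ inv m-free m-first) p-stable (Step.within′ inv m-free m-first p-stable p-within)

  run-⊆ : ∀ {s s′ : GSState n} → Star GSStep s s′ → ∀ m {x} → x ∈ ml (lsts s′) m → x ∈ ml (lsts s) m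
  run-⊆ ε m x∈ = x∈
  run-⊆ {s} (step m₀ w _ _ _ ◅ steps) m x∈ = Propose.ml-⊆ s m₀ w m (run-⊆ steps m x∈)

  run-length : ∀ {s s′ : GSState n} → Star GSStep s s′ → ∀ m → length (ml (lsts s′) m) ≤ length (ml (lsts s) m)
  run-length ε m = ≤-refl
  run-length {s} (step m₀ w _ _ _ ◅ steps) m = ≤-trans (run-length steps m) (Propose.length-ml s m₀ w m)

  unengaged : Maybe (Fin n) → ℕ
  unengaged nothing = 1
  unengaged (just _) = 0

  unengaged-propose : ∀ s m w w′ → unengaged (eng (propose s m w) w′) ≤ unengaged (eng s w′)
  unengaged-propose s m w w′ with w ≟ w′
  ... | yes refl = z≤n
  ... | no _ = ≤-refl

  total-length : Lists n → ℕ
  total-length L = sumFin (λ m → length (ml L m))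

  measure : GSState n → ℕ
  measure s = total-length (lsts s) + sumFin (λ w → unengaged (eng s w))

  -- Either w was free (one fewer free woman) or her fiancé is rejected and loses w from his list.
  propose-decreases : ∀ {s m w rest} → Invariant s → Free s m → ml (lsts s) m ≡ w ∷ rest →
    measure (propose s m w) < measure s
  propose-decreases {s} {m} {w} inv m-free m-first with eng s w in w-status
  ... | nothing = +-mono-≤-< (sumFin-mono-≤ _ _ length-ml) (sumFin-mono-< _ _ (unengaged-propose s m w) w w-now-engaged)
    where
    open Propose s m w
    w-now-engaged : unengaged (eng s′ w) < unengaged (eng s w)
    w-now-engaged = subst₂ (λ a b → unengaged a < unengaged b) (sym eng-proposee) (sym w-status) (s≤s z≤n)
  ... | just m′ = +-mono-<-≤ (sumFin-mono-< _ _ length-ml m′ m′-shrinks) (sumFin-mono-≤ _ _ (unengaged-propose s m w))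
    where
    open Propose s m w
    open Invariant inv
    m′≢m : m′ ≢ m
    m′≢m refl = m-free w w-status
    m′∈rejected : m′ ∈ rejected
    m′∈rejected with xs , wl≡ ← fiancé-last w m′ w-status =
      last∈after (wl L w) xs (Step.m∈wl inv m-free m-first) wl≡ m′≢m
    m′-shrinks : length (ml L′ m′) < length (ml L m′)
    m′-shrinks with rest′ , ml≡ ← fiancée-first w m′ w-status =
      subst (λ l → length l < length (ml L m′)) (sym (ml-rejected m′ m′∈rejected))
        (length-remove-< (ml L m′) (subst (w ∈_) (sym ml≡) (here refl)))

  record Completion (Q : GSState n → Set) (s : GSState n) : Set where
    field
      final     : GSState n
      steps     : Star GSStep s final
      terminal  : ∀ m → Free final m → ⊥
      invariant : Invariant final
      property  : Q final

  run-to-completion : (Q : GSState n → Set) →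
    (∀ {s m w rest} → Invariant s → Q s → Free s m → ml (lsts s) m ≡ w ∷ rest → Q (propose s m w)) →
    (∀ {s m} → Invariant s → Q s → Free s m → ∃ λ w → ∃ λ rest → ml (lsts s) m ≡ w ∷ rest) →
    ∀ {s} → Invariant s → Q s → Completion Q s
  run-to-completion Q Q-preserved free⇒proposes {s} inv q = go s inv q (<-wellFounded (measure s))
    where
    go : ∀ s → Invariant s → Q s → Acc _<_ (measure s) → Completion Q s
    go s inv q (acc smaller) with any? (λ m → all? (λ w → ¬? (≡-dec _≟_ (eng s w) (just m))))
    ... | no no-free-man = record
      { final = s ; steps = ε ; terminal = λ m m-free → no-free-man (m , m-free) ; invariant = inv ; property = q }
    ... | yes (m , m-free) with w , rest , m-first ← free⇒proposes inv q m-free =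
      record { final = final ; steps = step m w rest m-free m-first ◅ steps ; terminal = terminal
             ; invariant = invariant ; property = property }
      where
      rest-of-run : Completion Q (propose s m w)
      rest-of-run = go (propose s m w) (Step.invariant′ inv m-free m-first) (Q-preserved inv q m-free m-first)
                      (smaller (propose-decreases inv m-free m-first))
      open Completion rest-of-run

  module Terminal {s : GSState n} (inv : Invariant s) (no-free-man : ∀ m → Free s m → ⊥) where
    open Invariant inv
    open Consistent consistent

    engaged : ∀ m → ∃ λ w → eng s w ≡ just m
    engaged m with any? (λ w → ≡-dec _≟_ (eng s w) (just m))
    ... | yes found = found
    ... | no none = ⊥-elim (no-free-man m (λ w e → none (w , e)))

    fiancée-injective : ∀ x y → proj₁ (engaged x) ≡ proj₁ (engaged y) → x ≡ y
    fiancée-injective x y eq = just-injective (trans (sym (proj₂ (engaged x))) (trans (cong (eng s) eq) (proj₂ (engaged y))))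

    X : Matching n
    X = swapMatching (fromInjective (proj₁ ∘ engaged) fiancée-injective)

    X-represents : X Represents eng s
    X-represents = represents λ w →
      subst (λ w′ → eng s w′ ≡ just (manOf X w)) (womanOf-manOf X w) (proj₂ (engaged (manOf X w)))

    X-first : ∀ m → StartsWith (womanOf X m) (ml (lsts s) m)
    X-first m = fiancée-first (womanOf X m) m (proj₂ (engaged m))

    X-last : ∀ w → EndsWith (manOf X w) (wl (lsts s) w)
    X-last w = fiancé-last w (manOf X w) (matches X-represents w)

    sorted-from-X : ∀ m → SortedBy (rankM m) (womanOf X m ∷ proj₁ (X-first m))
    sorted-from-X m = subst (SortedBy (rankM m)) (proj₂ (X-first m)) (men-sorted m)

    X-optimal : ∀ p → Within (lsts s) p → ∀ m → rankM m (womanOf X m) ≤ rankM m (womanOf p m)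
    X-optimal p p-within m with subst (womanOf p m ∈_) (proj₂ (X-first m)) (p-within m)
    ... | here pm≡Xm = ≤-reflexive (cong (rankM m) (sym pm≡Xm))
    ... | there pm∈rest = <⇒≤ (head-rank< (sorted-from-X m) pm∈rest)

    X-stable : RankStable X
    X-stable = rankStable λ m w w-prefers-m m-prefers-w →
      case subst (w ∈_) (proj₂ (X-first m)) (on-hers⇒on-his m w (m∈wl m w w-prefers-m)) of λ where
        (here refl) → <-irrefl refl m-prefers-w
        (there w∈rest) → <-asym m-prefers-w (head-rank< (sorted-from-X m) w∈rest)
      where
      m∈wl : ∀ m w → rankW w m < rankW w (manOf X w) → m ∈ wl (lsts s) w
      m∈wl m w w-prefers-m with xs , wl≡ ← X-last w =
        IsPrefix-downClosed (women-prefix w) (subst (manOf X w ∈_) (sym wl≡) (∈-++⁺ʳ xs (here refl))) w-prefers-m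

  module AfterDeletion {s : GSState n} (inv : Invariant s) (no-free-man : ∀ m → Free s m → ⊥) where
    open Terminal inv no-free-man public
    open Deletion (lsts s) X X-first
    open Consistent (Invariant.consistent inv)

    L″ : Lists n
    L″ = delStep (lsts s)

    ml-L″ : ∀ m → ml L″ m ≡ proj₁ (X-first m)
    ml-L″ m = trans (ml-delStep m) (cong tail (proj₂ (X-first m)))

    wl-L″ : ∀ w → wl L″ w ≡ proj₁ (X-last w)
    wl-L″ w = trans (wl-delStep w) (trans (cong dropLast (proj₂ (X-last w))) (dropLast-∷ʳ _ _))

    ml-L″-⊆ : ∀ m {x} → x ∈ ml L″ m → x ∈ ml (lsts s) m
    ml-L″-⊆ m x∈ = subst (_ ∈_) (sym (proj₂ (X-first m))) (there (subst (_ ∈_) (ml-L″ m) x∈))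

    ∉-ml-L″ : ∀ m {x} → x ∈ ml L″ m → x ≢ womanOf X m
    ∉-ml-L″ m x∈ refl = <-irrefl refl (head-rank< (sorted-from-X m) (subst (womanOf X m ∈_) (ml-L″ m) x∈))

    within″ : ∀ p → Within (lsts s) p → EdgeDisjoint p X → Within L″ p
    within″ p p-within p∩X=∅ m with subst (womanOf p m ∈_) (proj₂ (X-first m)) (p-within m)
    ... | here pm≡Xm = ⊥-elim (p∩X=∅ m pm≡Xm)
    ... | there pm∈rest = subst (_ ∈_) (sym (ml-L″ m)) pm∈rest

    consistent″ : Consistent L″
    consistent″ = record
      { on-his⇒on-hers = on-his⇒on-hers″ ; on-hers⇒on-his = on-hers⇒on-his″
      ; men-sorted = men-sorted″ ; women-prefix = women-prefix″ }
      where
      on-his⇒on-hers″ : ∀ m w → w ∈ ml L″ m → m ∈ wl L″ w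
      on-his⇒on-hers″ m w w∈
        with ∈-++⁻ (proj₁ (X-last w)) (subst (m ∈_) (proj₂ (X-last w)) (on-his⇒on-hers m w (ml-L″-⊆ m w∈)))
      ... | inj₁ m∈ = subst (m ∈_) (sym (wl-L″ w)) m∈
      ... | inj₂ (here m≡Xw) = ⊥-elim (∉-ml-L″ m w∈ (sym (manOf≡⇒womanOf≡ X (sym m≡Xw))))
      on-hers⇒on-his″ : ∀ m w → m ∈ wl L″ w → w ∈ ml L″ m
      on-hers⇒on-his″ m w m∈″ with subst (w ∈_) (proj₂ (X-first m)) (on-hers⇒on-his m w m∈)
        where
        m∈ : m ∈ wl (lsts s) w
        m∈ = subst (m ∈_) (sym (proj₂ (X-last w))) (∈-++⁺ˡ (subst (m ∈_) (wl-L″ w) m∈″))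
      ... | there w∈rest = subst (w ∈_) (sym (ml-L″ m)) w∈rest
      ... | here w≡Xm = ⊥-elim (Unique-++⇒∉ (proj₁ (X-last w)) [ manOf X w ] unique
                                  (subst (m ∈_) (wl-L″ w) m∈″) (here (sym (womanOf≡⇒manOf≡ X (sym w≡Xm)))))
        where
        unique : Unique (proj₁ (X-last w) ++ [ manOf X w ])
        unique = subst Unique (proj₂ (X-last w)) (Unique-wl w)
      men-sorted″ : ∀ m → SortedBy (rankM m) (ml L″ m)
      men-sorted″ m with _ ∷ sorted-rest ← sorted-from-X m = subst (SortedBy (rankM m)) (sym (ml-L″ m)) sorted-rest
      women-prefix″ : ∀ w → IsPrefix (wl L″ w) (prefW w)
      women-prefix″ w = subst (λ l → IsPrefix l (prefW w)) (sym (wl-delStep w))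
                          (IsPrefix-trans (dropLast-isPrefix (wl (lsts s) w)) (women-prefix w))

    total-length-decreases : Fin n → total-length L″ < total-length (lsts s)
    total-length-decreases m₀ = sumFin-mono-< _ _ (<⇒≤ ∘ shorter) m₀ (shorter m₀)
      where
      shorter : ∀ m → length (ml L″ m) < length (ml (lsts s) m)
      shorter m = subst₂ (λ a b → length a < length b) (sym (ml-L″ m)) (sym (proj₂ (X-first m))) ≤-refl

  initial-consistent : Consistent (initLists G)
  initial-consistent = record
    { on-his⇒on-hers = λ m w _ → ∈-prefW w m ; on-hers⇒on-his = λ m w _ → ∈-prefM m w
    ; men-sorted = λ m → Before⇒AllPairs (prefM m) (Before⇒rank< (prefM m) (Unique-prefM m))
    ; women-prefix = λ w → IsPrefix-refl (prefW w) }

  initial-within : ∀ p → Within (initLists G) p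
  initial-within p m = ∈-prefM m (womanOf p m)

module WomanOptimality {n : ℕ} (G : Instance n) where
  open Instance G
  open Preferences G
  open Lattice G using (RankStable-swap; RankStable-unswap)
  private module GS = GaleShapley (swapSides G)

  -- A man leaves a woman's list only when he receives a proposal, and from then on he stays engaged.
  RejectedEngaged : GSState n → Set
  RejectedEngaged s = ∀ w m → m ∉ ml (lsts s) w → ∃ λ w′ → eng s m ≡ just w′

  RejectedEngaged-propose : ∀ {s w m rest} → GS.Invariant s → RejectedEngaged s → Free s w → ml (lsts s) w ≡ m ∷ rest →
    RejectedEngaged (propose s w m)
  RejectedEngaged-propose {s} {w} {m} _ engaged _ _ w′ m′ m′∉ with m ≟ m′
  ... | yes refl = w , refl
  ... | no m≢m′ = engaged w′ m′ (λ m′∈ → m′∉ (GS.Propose.ml-⊇ s w m w′ m′∈ (m≢m′ ∘ sym)))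

  -- A free woman with an empty list would leave n men engaged to at most n − 1 women.
  free⇒proposes : ∀ {s w} → GS.Invariant s → RejectedEngaged s → Free s w →
    ∃ λ m → ∃ λ rest → ml (lsts s) w ≡ m ∷ rest
  free⇒proposes {s} {w} inv engaged w-free with ml (lsts s) w in w-list
  ... | m ∷ rest = m , rest , refl
  ... | [] = ⊥-elim (w-free m₀ (subst (λ w′ → eng s m₀ ≡ just w′) fiancée-m₀ (proj₂ (all-engaged m₀))))
    where
    all-engaged : ∀ m → ∃ λ w′ → eng s m ≡ just w′
    all-engaged m = engaged w m (λ m∈ → case subst (m ∈_) w-list m∈ of λ ())
    fiancée-injective : ∀ x y → proj₁ (all-engaged x) ≡ proj₁ (all-engaged y) → x ≡ y
    fiancée-injective x y eq = GS.Invariant.engaged-once inv x y (proj₁ (all-engaged x)) (proj₂ (all-engaged x))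
      (subst (λ w′ → eng s y ≡ just w′) (sym eq) (proj₂ (all-engaged y)))
    m₀ : Fin n
    m₀ = proj₁ (injective⇒surjective (proj₁ ∘ all-engaged) fiancée-injective w)
    fiancée-m₀ : proj₁ (all-engaged m₀) ≡ w
    fiancée-m₀ = proj₂ (injective⇒surjective (proj₁ ∘ all-engaged) fiancée-injective w)

  womenProposing : GS.Completion RejectedEngaged (GS.initial (initLists (swapSides G)))
  womenProposing = GS.run-to-completion RejectedEngaged RejectedEngaged-propose free⇒proposes
    (GS.initial-invariant GS.initial-consistent) (λ w m m∉ → ⊥-elim (m∉ (∈-prefW w m)))

  open GS.Completion womenProposing
  open GS.Terminal invariant terminal using (X; X-stable; X-optimal)

  womanOptimal-exists : Σ (WMap n) (WomanOptimal G)
  womanOptimal-exists = toWMap (swapMatching X) ,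
    RankStable⇒Stable (represents λ _ → refl) (RankStable-unswap X-stable) , no-better
    where
    no-better : ∀ μ → Stable G μ → ∀ w m m′ → just (womanOf X w) ≡ just m → μ w ≡ just m′ →
      m ≡ m′ ⊎ Before m m′ (prefW w)
    no-better μ μ-stable w m m′ Xw≡m μw≡m′ with <-cmp (rankW w m) (rankW w m′)
    ... | tri< lt _ _ = inj₂ (rank<⇒Before (prefW w) (∈-prefW w m) (∈-prefW w m′) lt)
    ... | tri≈ _ eq _ = inj₁ (rankW-injective w eq)
    ... | tri> _ _ gt = ⊥-elim (<-irrefl refl (<-≤-trans gt X-best))
      where
      p : Σ (Matching n) (_Represents μ)
      p = Perfect⇒Matching μ (proj₁ μ-stable)
      swapped-within : GS.Within (lsts final) (swapMatching (proj₁ p))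
      swapped-within = GS.run-within steps (GS.initial-invariant GS.initial-consistent)
        (RankStable-swap (Stable⇒RankStable (proj₂ p) μ-stable)) (GS.initial-within (swapMatching (proj₁ p)))
      X-best : rankW w m ≤ rankW w m′
      X-best = subst₂ (λ a b → rankW w a ≤ rankW w b) (just-injective Xw≡m)
                 (just-injective (trans (sym (matches (proj₂ p) w)) μw≡m′))
                 (X-optimal (swapMatching (proj₁ p)) swapped-within w)

module Pessimality {n : ℕ} (G : Instance n) {Mz : WMap n} (Mz-optimal : WomanOptimal G Mz) where
  open Instance G
  open Preferences G

  pz : Matching n
  pz = proj₁ (Perfect⇒Matching Mz (proj₁ (proj₁ Mz-optimal)))

  pz-represents : pz Represents Mz
  pz-represents = proj₂ (Perfect⇒Matching Mz (proj₁ (proj₁ Mz-optimal)))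

  pz-stable : RankStable pz
  pz-stable = Stable⇒RankStable pz-represents (proj₁ Mz-optimal)

  pz-pessimal : ∀ {p} → RankStable p → ∀ m → rankM m (womanOf p m) ≤ rankM m (womanOf pz m)
  pz-pessimal {p} p-stable m with rankM m (womanOf p m) ≤? rankM m (womanOf pz m)
  ... | yes le = le
  ... | no nle with proj₂ Mz-optimal (toWMap p) (RankStable⇒Stable (represents λ _ → refl) p-stable)
                      w m (manOf p w) (represents-manOf pz-represents m) refl
    where w = womanOf pz m
  ...   | inj₁ m≡pw = ⊥-elim (nle (≤-reflexive (cong (rankM m) (manOf≡⇒womanOf≡ p (sym m≡pw)))))
  ...   | inj₂ m<pw = ⊥-elim (unblocked p-stable m (womanOf pz m)
                        (Before⇒rank< (prefW (womanOf pz m)) (Unique-prefW (womanOf pz m)) m<pw) (≰⇒> nle))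

module Uncrossing {n : ℕ} (G : Instance n) (L : Lists n) where
  open Preferences G
  open Lattice G
  open GaleShapley G using (Within)

  PairsFrom : Matching n → List (Matching n) → Matching n → Set
  PairsFrom A R ν = ∀ m → womanOf ν m ≡ womanOf A m ⊎ Any (λ ρ → womanOf ν m ≡ womanOf ρ m) R

  WorseForAll : Matching n → Matching n → Set
  WorseForAll A ν = ∀ m → rankM m (womanOf A m) < rankM m (womanOf ν m)

  record Uncrossed (A : Matching n) (R : List (Matching n)) : Set where
    field
      best          : Matching n
      best-stable   : RankStable best
      best-within   : Within L best
      best-≤        : ∀ m → rankM m (womanOf best m) ≤ rankM m (womanOf A m)
      lower         : List (Matching n)
      length-lower  : length lower ≡ length R
      lower-stable  : All RankStable lower
      lower-within  : All (Within L) lower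
      lower-disjoint : AllPairs EdgeDisjoint lower
      lower-worse   : All (WorseForAll best) lower
      lower-from    : All (PairsFrom A R) lower

  within-either : ∀ (p q r : Matching n) → (∀ m → womanOf r m ≡ womanOf p m ⊎ womanOf r m ≡ womanOf q m) →
    Within L p → Within L q → Within L r
  within-either p q r r-either p-within q-within m with r-either m
  ... | inj₁ eq = subst (_∈ ml L m) (sym eq) (p-within m)
  ... | inj₂ eq = subst (_∈ ml L m) (sym eq) (q-within m)

  disjoint-either : ∀ (p q r : Matching n) → (∀ m → womanOf r m ≡ womanOf p m ⊎ womanOf r m ≡ womanOf q m) →
    ∀ ρ → EdgeDisjoint p ρ → EdgeDisjoint q ρ → EdgeDisjoint r ρ
  disjoint-either p q r r-either ρ p∩ρ=∅ q∩ρ=∅ m eq with r-either m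
  ... | inj₁ r≡p = p∩ρ=∅ m (trans (sym r≡p) eq)
  ... | inj₂ r≡q = q∩ρ=∅ m (trans (sym r≡q) eq)

  uncross : ∀ {A} → RankStable A → Within L A → ∀ R → All RankStable R → All (Within L) R →
    AllPairs EdgeDisjoint R → All (EdgeDisjoint A) R → Uncrossed A R
  uncross {A} A-stable A-within [] _ _ _ _ = record
    { best = A ; best-stable = A-stable ; best-within = A-within ; best-≤ = λ _ → ≤-refl
    ; lower = [] ; length-lower = refl ; lower-stable = [] ; lower-within = [] ; lower-disjoint = []
    ; lower-worse = [] ; lower-from = [] }
  uncross {A} A-stable A-within (μ ∷ R) (μ-stable ∷ R-stable) (μ-within ∷ R-within) (μ∩R=∅ ∷ R-disjoint)
    (A∩μ=∅ ∷ A∩R=∅) =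
    record
      { best = best ; best-stable = best-stable ; best-within = best-within
      ; best-≤ = λ m → ≤-trans (best-≤ m) (join-≤ˡ A-stable μ-stable m)
      ; lower = M ∷ lower ; length-lower = cong suc length-lower
      ; lower-stable = meet-stable ∷ lower-stable
      ; lower-within = within-either A μ M womanOf-meet A-within μ-within ∷ lower-within
      ; lower-disjoint = All.map {P = PairsFrom J R} (λ {ν} → M-disjoint {ν}) lower-from ∷ lower-disjoint
      ; lower-worse = (λ m → ≤-<-trans (best-≤ m) (join<meet A-stable μ-stable m (A∩μ=∅ m))) ∷ lower-worse
      ; lower-from = M-from ∷ All.map {P = PairsFrom J R} (λ {ν} → from-J {ν}) lower-from }
    where
    open Meet A-stable μ-stable
    J M : Matching n
    J = join A-stable μ-stable
    M = meet
    rec : Uncrossed J R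
    rec = uncross (join-stable A-stable μ-stable) (within-either A μ J (womanOf-join A-stable μ-stable) A-within μ-within) R
            R-stable R-within R-disjoint
            (All.zipWith (λ {ρ} (A∩ρ=∅ , μ∩ρ=∅) →
                            disjoint-either A μ J (womanOf-join A-stable μ-stable) ρ A∩ρ=∅ μ∩ρ=∅)
              (A∩R=∅ , μ∩R=∅))
    open Uncrossed rec
    M-disjoint : ∀ {ν} → PairsFrom J R ν → EdgeDisjoint M ν
    M-disjoint ν-from m M≡ν with ν-from m
    ... | inj₁ ν≡J = <-irrefl (cong (rankM m) (sym (trans M≡ν ν≡J))) (join<meet A-stable μ-stable m (A∩μ=∅ m))
    ... | inj₂ ν∈R with (A∩ρ=∅ , μ∩ρ=∅) , ν≡ρ ← All.lookupAny (All.zip (A∩R=∅ , μ∩R=∅)) ν∈R =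
      disjoint-either A μ M womanOf-meet (Any.lookup ν∈R) A∩ρ=∅ μ∩ρ=∅ m (trans M≡ν ν≡ρ)
    M-from : PairsFrom A (μ ∷ R) M
    M-from m with womanOf-meet m
    ... | inj₁ M≡A = inj₁ M≡A
    ... | inj₂ M≡μ = inj₂ (here M≡μ)
    from-J : ∀ {ν} → PairsFrom J R ν → PairsFrom A (μ ∷ R) ν
    from-J ν-from m with ν-from m
    ... | inj₂ ν∈R = inj₂ (there ν∈R)
    ... | inj₁ ν≡J with womanOf-join A-stable μ-stable m
    ...   | inj₁ J≡A = inj₁ (trans ν≡J J≡A)
    ...   | inj₂ J≡μ = inj₂ (here (trans ν≡J J≡μ))

module Algorithm {n : ℕ} (G : Instance n) {Mz : WMap n} (Mz-optimal : WomanOptimal G Mz) where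
  open Preferences G
  open GaleShapley G
  open Pessimality G Mz-optimal

  PairsOn : Lists n → WMap n → Set
  PairsOn L μ = ∀ m w → μ w ≡ just m → w ∈ ml L m

  Within⇒PairsOn : ∀ {p μ} L → p Represents μ → Within L p → PairsOn L μ
  Within⇒PairsOn L p⊢μ p-within m w μw≡m = subst (_∈ ml L m) (represents-womanOf p⊢μ μw≡m) (p-within m)

  module Round {L s} (L-consistent : Consistent L) (steps : Star GSStep (initial L) s) (terminal : ∀ m → Free s m → ⊥) where
    inv₀ : Invariant (initial L)
    inv₀ = initial-invariant L-consistent
    open AfterDeletion (run-invariant steps inv₀) terminal public

    lift : ∀ {p} → RankStable p → Within L p → Within (lsts s) p
    lift = run-within steps inv₀

    pz-within″ : Within L pz → Disjoint (eng s) Mz → Within L″ pz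
    pz-within″ pz-within X∩Mz=∅ =
      within″ pz (lift pz-stable pz-within) (λ m same → Disjoint⇒EdgeDisjoint X-represents pz-represents X∩Mz=∅ m (sym same))

  loop-sound : ∀ {L S} → Loop Mz L S → Consistent L → Within L pz →
    All (Stable G) S × AllPairs Disjoint S × All (PairsOn L) S
  loop-sound {L} (done _ _) _ pz-within =
    proj₁ Mz-optimal ∷ [] , [] ∷ [] , Within⇒PairsOn L pz-represents pz-within ∷ []
  loop-sound {L} (next (s , steps , terminal , refl , refl) X∩Mz=∅ loop) L-consistent pz-within =
    let S-stable , S-disjoint , S-on = loop-sound loop consistent″ (pz-within″ pz-within X∩Mz=∅) in
    RankStable⇒Stable X-represents X-stable ∷ S-stable ,
    All.map (λ {μ} → disjoint-from-X {μ}) S-on ∷ S-disjoint ,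
    X-on ∷ All.map (λ {μ} → on-L {μ}) S-on
    where
    open Round L-consistent steps terminal
    X-on : PairsOn L (eng s)
    X-on = Within⇒PairsOn L X-represents (λ m → run-⊆ steps m (subst (womanOf X m ∈_) (sym (proj₂ (X-first m))) (here refl)))
    disjoint-from-X : ∀ {μ} → PairsOn L″ μ → Disjoint (eng s) μ
    disjoint-from-X μ-on m w Xw≡m μw≡m = ∉-ml-L″ m (μ-on m w μw≡m) (sym (represents-womanOf X-represents Xw≡m))
    on-L : ∀ {μ} → PairsOn L″ μ → PairsOn L μ
    on-L μ-on m w μw≡m = run-⊆ steps m (ml-L″-⊆ m (μ-on m w μw≡m))

  loop-maximal : ∀ {L S} → Loop Mz L S → Consistent L → Within L pz →
    ∀ F → All RankStable F → All (Within L) F → AllPairs EdgeDisjoint F → length F ≤ length S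
  loop-maximal _ _ _ [] _ _ _ = z≤n
  loop-maximal (done _ _) _ _ (_ ∷ []) _ _ _ = s≤s z≤n
  loop-maximal {L} (done (s , steps , terminal , refl , refl) X∩Mz≢∅) L-consistent _
    (p ∷ q ∷ _) (p-stable ∷ q-stable ∷ _) (p-within ∷ q-within ∷ _) ((p∩q=∅ ∷ _) ∷ _) =
    case shared-or-disjoint X pz of λ where
      (inj₂ X∩pz=∅) → ⊥-elim (X∩Mz≢∅ (EdgeDisjoint⇒Disjoint X-represents pz-represents X∩pz=∅))
      (inj₁ (m , X≡pz)) → ⊥-elim (p∩q=∅ m
        (trans (agrees-with-X p-stable p-within m X≡pz) (sym (agrees-with-X q-stable q-within m X≡pz))))
    where
    open Round L-consistent steps terminal
    agrees-with-X : ∀ {r} → RankStable r → Within L r → ∀ m → womanOf X m ≡ womanOf pz m → womanOf r m ≡ womanOf X m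
    agrees-with-X {r} r-stable r-within m X≡pz = rankM-injective m (≤-antisym
      (subst (λ w → rankM m (womanOf r m) ≤ rankM m w) (sym X≡pz) (pz-pessimal r-stable m))
      (X-optimal r (lift r-stable r-within) m))
  loop-maximal {L} (next (s , steps , terminal , refl , refl) X∩Mz=∅ loop) L-consistent pz-within
    (A ∷ R) (A-stable ∷ R-stable) (A-within ∷ R-within) (A∩R=∅ ∷ R-disjoint) =
    s≤s (subst (_≤ _) length-lower
      (loop-maximal loop consistent″ (pz-within″ pz-within X∩Mz=∅) lower lower-stable lower-within″ lower-disjoint))
    where
    open Round L-consistent steps terminal
    open Uncrossing G (lsts s)
    open Uncrossed (uncross A-stable (lift A-stable A-within) R R-stable
                      (All.zipWith (λ (ρ-stable , ρ-within) → lift ρ-stable ρ-within) (R-stable , R-within)) R-disjoint A∩R=∅)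
    lower-within″ : All (Within L″) lower
    lower-within″ = All.zipWith (λ {ν} (ν-within , ν-worse) → within″ ν ν-within λ m same →
        <-irrefl (cong (rankM m) (sym same)) (≤-<-trans (X-optimal best best-within m) (ν-worse m)))
      (lower-within , lower-worse)

  loop-exists : Fin n → ∀ L → Consistent L → Within L pz → Σ (List (WMap n)) (Loop Mz L)
  loop-exists m₀ L L-consistent pz-within = go L L-consistent pz-within (<-wellFounded _)
    where
    proposes : ∀ {s m} → Invariant s → Within (lsts s) pz → Free s m → ∃ λ w → ∃ λ rest → ml (lsts s) m ≡ w ∷ rest
    proposes {s} {m} _ pz-within _ with ml (lsts s) m | pz-within m
    ... | w ∷ rest | _ = w , rest , refl
    go : ∀ L → Consistent L → Within L pz → Acc _<_ (total-length L) → Σ (List (WMap n)) (Loop Mz L)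
    go L L-consistent pz-within (acc smaller) = after-round
      (run-to-completion (λ s → Within (lsts s) pz)
        (λ inv pz-within m-free m-first → Step.within′ inv m-free m-first pz-stable pz-within) proposes
        (initial-invariant L-consistent) pz-within)
      where
      after-round : Completion (λ s → Within (lsts s) pz) (initial L) → Σ (List (WMap n)) (Loop Mz L)
      after-round c = case shared-or-disjoint X pz of λ where
          (inj₁ (m , X≡pz)) → Mz ∷ [] , done run λ X∩Mz=∅ →
            Disjoint⇒EdgeDisjoint X-represents pz-represents X∩Mz=∅ m X≡pz
          (inj₂ X∩pz=∅) → let X∩Mz=∅ = EdgeDisjoint⇒Disjoint X-represents pz-represents X∩pz=∅
                              S , loop = go L″ consistent″ (pz-within″ pz-within X∩Mz=∅) (smaller L″-shorter)
                          in eng final ∷ S , next run X∩Mz=∅ loop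
        where
        open Completion c
        open Round L-consistent steps terminal
        run : GSExt L (lsts final) (eng final)
        run = final , steps , terminal , refl , refl
        L″-shorter : total-length L″ < total-length L
        L″-shorter = <-≤-trans (total-length-decreases m₀) (sumFin-mono-≤ _ _ (run-length steps))

  output-exists : Fin n → Σ (List (WMap n)) (Loop Mz (initLists G))
  output-exists m₀ = loop-exists m₀ (initLists G) initial-consistent (initial-within pz)

  output-sound : ∀ {S} → Loop Mz (initLists G) S → All (Stable G) S × AllPairs Disjoint S
  output-sound loop =
    let S-stable , S-disjoint , _ = loop-sound loop initial-consistent (initial-within pz) in S-stable , S-disjoint

  output-maximal : ∀ {S} → Loop Mz (initLists G) S → ∀ T → All (Stable G) T → AllPairs Disjoint T → length T ≤ length S
  output-maximal {S} loop T T-stable T-disjoint =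
    let F , F⊢T = represent T T-stable in
    subst (_≤ length S) (Pointwise-length F⊢T)
      (loop-maximal loop initial-consistent (initial-within pz) F (Pointwise-RankStable F⊢T T-stable)
        (All.tabulate (λ {p} _ → initial-within p)) (Pointwise-EdgeDisjoint F⊢T T-disjoint))

theorem10 : (k : ℕ) (G : Instance (suc k)) →
    Σ (List (WMap (suc k))) (λ S → DSM G S) ×
    ((S : List (WMap (suc k))) → DSM G S →
      All (Stable G) S × AllPairs Disjoint S ×
      ((T : List (WMap (suc k))) → All (Stable G) T → AllPairs Disjoint T →
        length T ≤ length S))
theorem10 k G = (proj₁ run , Mz , Mz-optimal , proj₂ run) , correctness
  where
  open WomanOptimality G using (womanOptimal-exists)
  Mz : WMap (suc k)
  Mz = proj₁ womanOptimal-exists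
  Mz-optimal : WomanOptimal G Mz
  Mz-optimal = proj₂ womanOptimal-exists
  run : Σ (List (WMap (suc k))) (Loop Mz (initLists G))
  run = Algorithm.output-exists G Mz-optimal zero
  correctness : ∀ S → DSM G S → All (Stable G) S × AllPairs Disjoint S ×
    (∀ T → All (Stable G) T → AllPairs Disjoint T → length T ≤ length S)
  correctness S (_ , Mz′-optimal , loop) = let open Algorithm G Mz′-optimal in
    proj₁ (output-sound loop) , proj₂ (output-sound loop) , output-maximal loop
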